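{- In the setting of the context, for every integer $h$ (representing the class $h\in\mathbb{Z}/2|D|\mathbb{Z}\cong P'/P$) and every $\ell\in\mathbb{Z}+h^2/4|D|$, the Fourier coefficient of $F_A$ is \[ c_A(h,\ell)=\sum_{\substack{\lambda\in K'\\(\lambda,A)=h}}c_{F_m}\big(\lambda,\ \ell+Q(\lambda)-h^2/4|D|\big). \]
   Context: $m\in\{1,2,3\}$; $a,c\in\mathbb{N}$, $b_1,\dots,b_m\in\mathbb{Z}$ with $D=b_1^2+\dots+b_m^2-4ac<0$. $K=\mathbb{Z}^{m+2}$ with $Q(\alpha,\beta_1,\dots,\beta_m,\gamma)=4\alpha\gamma-\sum\beta_j^2$, bilinear form $(x,y)=Q(x+y)-Q(x)-Q(y)$, dual $K'=\{(\alpha/4,\beta_1/2,\dots,\beta_m/2,\gamma/4)\}$. For $\lambda\in K'$ as written, $\operatorname{sgn}(\lambda)=(-1)^{(\alpha+1)(\gamma+1)}$; $\mu\in K'/K$ is the class with $\alpha\equiv\gamma\equiv2\pmod4$ and all $\beta_j$ odd; $2(K'/K)=\{2\nu\}$, and for $\lambda\in2(K'/K)$, $\operatorname{sgn}(\lambda/2)=-1$ if $\lambda=0$ and $+1$ otherwise. $f=1/\theta$, $\theta=\sum_{n\in\mathbb{Z}}q^{n^2}$, $q=e^{2\pi i\tau}$; $g(\tau)=f(\tau/4)$; $h_0=\eta(2\tau)/\eta(4\tau)^2$; $g^m_j$ is the part of $g^m$ with exponents $\equiv j\pmod1$. $F_m=h_0^m\mathfrak{e}_\mu+\sum_{\lambda\in2(K'/K)}\operatorname{sgn}(\lambda/2)2^{m-1}f^m\mathfrak{e}_\lambda-\sum_{\lambda\in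 K'/K}\operatorname{sgn}(\lambda)2^mg^m_{Q(\lambda)}\mathfrak{e}_\lambda$ (a $\mathbb{C}[K'/K]$-valued $q$-series), with coefficient $c_{F_m}(\lambda,n)$ of $q^n$ in the component $\lambda+K$. $A$ denotes the vector $(a,b_1,\dots,b_m,c)\in K$, $Q(A)=|D|$; $P=\mathbb{Z}A$, $N=A^\perp\cap K$, $N(-1)=(N,-Q)$. Since $K'\subset(P\oplus N)'$, $F_{m,P\oplus N,\beta}=F_{m,\beta+K}$ if $\beta\in K'/(P\oplus N)$ and $0$ otherwise. $\Theta_{N(-1),\alpha}=\sum_{x\in N+\alpha}q^{ -Q(x)}$ for $\alpha\in N'/N$. $F_A=\sum_{\beta\in P'/P}\big(\sum_{\alpha\in N'/N}F_{m,P\oplus N,\alpha+\beta}\Theta_{N(-1),\alpha}\big)\mathfrak{e}_\beta$. $P'/P$ is identified with $\mathbb{Z}/2|D|\mathbb{Z}$ via $h\mapsto\frac{h}{2|D|}A$, and $F_A=\sum_h\sum_\ell c_A(h,\ell)q^\ell\mathfrak{e}_h$. -}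

module Defs where

open import Data.Nat as ℕ using (ℕ; zero; suc)
open import Data.Integer as ℤ using (ℤ; +_)
open import Data.Rational as ℚ using (ℚ)
import Data.Rational.Properties as ℚP
open import Data.Vec as Vec using (Vec; []; _∷_)
import Data.Vec.Relation.Unary.All as VAll
open import Data.List as List using (List; []; _∷_)
open import Data.List.Relation.Unary.All using (All)
open import Data.List.Relation.Unary.AllPairs using (AllPairs)
open import Data.List.Relation.Unary.Unique.Propositional using (Unique)
open import Data.List.Membership.Propositional using (_∈_)
open import Data.Product using (Σ; ∃; _×_; _,_)
open import Data.Bool using (Bool; true; false; if_then_else_; _∧_; _∨_; not)
open import Relation.Nullary using (¬_; does; yes; no)
open import Relation.Binary.PropositionalEquality using (_≡_; _≢_)

-- Formal power series in q with integer coefficients: PS = ℕ → ℤ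
-- (s n = coefficient of q^n).

PS : Set
PS = ℕ → ℤ

sumℤ : List ℤ → ℤ
sumℤ = List.foldr ℤ._+_ (+ 0)

conv : PS → PS → PS
conv s t n = sumℤ (List.map (λ i → s i ℤ.* t (n ℕ.∸ i)) (List.upTo (suc n)))

oneS : PS
oneS zero    = + 1
oneS (suc _) = + 0

powS : ℕ → PS → PS
powS zero    s = oneS
powS (suc k) s = conv s (powS k s)

-- coefficients c_n, c_{n-1}, ..., c_0 of 1/s, for s with constant term 1:
-- c_0 = 1, c_{n+1} = - Σ_{k=1}^{n+1} s_k c_{n+1-k}
invRev : PS → ℕ → List ℤ
invRev s zero    = + 1 ∷ []
invRev s (suc n) =
  ℤ.- sumℤ (List.zipWith (λ k c → s k ℤ.* c)
                         (List.map suc (List.upTo (suc n))) (invRev s n))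
  ∷ invRev s n

headℤ : List ℤ → ℤ
headℤ []      = + 0
headℤ (x ∷ _) = x

invS : PS → PS
invS s n = headℤ (invRev s n)

-- θ = Σ_{k ∈ ℤ} q^{k²}: coefficient of q^n = #{k ∈ ℤ : k² = n}
θS : PS
θS n = sumℤ (List.map (λ k → if does (k ℕ.* k ℕ.≟ n)
                              then (if does (k ℕ.≟ 0) then + 1 else + 2)
                              else + 0)
                      (List.upTo (suc n)))

fS : PS
fS = invS θS

oneMinusQ : ℕ → PS
oneMinusQ j i = if does (i ℕ.≟ 0) then + 1
                else (if does (i ℕ.≟ j) then ℤ.- (+ 1) else + 0)

truncE : ℕ → PS
truncE zero    = oneS
truncE (suc k) = conv (truncE k) (oneMinusQ (suc k))

-- E(q) = ∏_{n≥1} (1 - q^n)  (so η(τ) = q^{1/24} E(q))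
ES : PS
ES n = truncE n n

subS : (k : ℕ) → .{{_ : ℕ.NonZero k}} → PS → PS
subS k s n = if does (n ℕ.% k ℕ.≟ 0) then s (n ℕ./ k) else + 0

-- h_0^m = q^{-m/4} · H0S m (q), since h_0 = η(2τ)/η(4τ)² = q^{-1/4} E(q²)/E(q⁴)²
H0S : ℕ → PS
H0S m = conv (powS m (subS 2 ES)) (powS (2 ℕ.* m) (subS 4 (invS ES)))

ℤtoℚ : ℤ → ℚ
ℤtoℚ z = z ℚ./ 1

ℕtoℚ : ℕ → ℚ
ℕtoℚ n = ℤtoℚ (+ n)

IsInt : ℚ → Set
IsInt q = ℚ.denominatorℕ q ≡ 1

isInt : ℚ → Bool
isInt q = does (ℚ.denominatorℕ q ℕ.≟ 1)

-- total reciprocal (value 0 at 0; only used at nonzero arguments)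
recip : ℚ → ℚ
recip q with q ℚP.≟ ℚ.0ℚ
... | yes _   = ℚ.0ℚ
... | no q≢0 = ℚ.1/_ q {{ℚ.≢-nonZero q≢0}}

natCoef : PS → ℤ → ℤ
natCoef s (+ n)      = s n
natCoef s ℤ.-[1+ _ ] = + 0

coefAt : PS → ℚ → ℤ
coefAt s r = if isInt r then natCoef s (ℚ.numerator r) else + 0

-- The space K ⊗ ℚ = ℚ^{m+2}, coordinates (α, β_1..β_m, γ)

record V (m : ℕ) : Set where
  constructor vec
  field
    xa : ℚ
    xb : Vec ℚ m
    xc : ℚ
open V public

sumℚ : ∀ {m} → Vec ℚ m → ℚ
sumℚ = Vec.foldr _ ℚ._+_ ℚ.0ℚ

_⊕_ : ∀ {m} → V m → V m → V m
vec a b c ⊕ vec a' b' c' = vec (a ℚ.+ a') (Vec.zipWith ℚ._+_ b b') (c ℚ.+ c')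

_⊖_ : ∀ {m} → V m → V m → V m
vec a b c ⊖ vec a' b' c' = vec (a ℚ.- a') (Vec.zipWith ℚ._-_ b b') (c ℚ.- c')

_·_ : ∀ {m} → ℚ → V m → V m
t · vec a b c = vec (t ℚ.* a) (Vec.map (t ℚ.*_) b) (t ℚ.* c)

Qf : ∀ {m} → V m → ℚ
Qf (vec a b c) = ℕtoℚ 4 ℚ.* a ℚ.* c ℚ.- sumℚ (Vec.map (λ x → x ℚ.* x) b)

-- (x,y) = Q(x+y) - Q(x) - Q(y) = 4(αγ' + γα') - 2 Σ β_j β'_j
bil : ∀ {m} → V m → V m → ℚ
bil (vec a b c) (vec a' b' c') =
  ℕtoℚ 4 ℚ.* (a ℚ.* c' ℚ.+ c ℚ.* a')
  ℚ.- ℕtoℚ 2 ℚ.* sumℚ (Vec.zipWith ℚ._*_ b b')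

InK : ∀ {m} → V m → Set
InK (vec a b c) = IsInt a × VAll.All IsInt b × IsInt c

InK' : ∀ {m} → V m → Set
InK' (vec a b c) = InK (vec (ℕtoℚ 4 ℚ.* a) (Vec.map (ℕtoℚ 2 ℚ.*_) b) (ℕtoℚ 4 ℚ.* c))

inK' : ∀ {m} → V m → Bool
inK' (vec a b c) = isInt (ℕtoℚ 4 ℚ.* a)
                 ∧ Vec.foldr _ (λ x r → isInt (ℕtoℚ 2 ℚ.* x) ∧ r) true b
                 ∧ isInt (ℕtoℚ 4 ℚ.* c)

-- The components of F_m.  For λ = (α/4, β/2, γ/4) ∈ K' the integers
-- α, β_j, γ are recovered as numerators of 4·xa, 2·xb_j, 4·xc.

resℤ : ℤ → (d : ℕ) → .{{_ : ℕ.NonZero d}} → ℕ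
resℤ z d = z ℤ.%ℕ d

is : ℕ → ℕ → Bool
is x y = does (x ℕ.≟ y)

allV : ∀ {m} → (ℤ → Bool) → Vec ℤ m → Bool
allV p = Vec.foldr _ (λ x r → p x ∧ r) true

αI γI : ∀ {m} → V m → ℤ
αI x = ℚ.numerator (ℕtoℚ 4 ℚ.* xa x)
γI x = ℚ.numerator (ℕtoℚ 4 ℚ.* xc x)

βI : ∀ {m} → V m → Vec ℤ m
βI x = Vec.map (λ t → ℚ.numerator (ℕtoℚ 2 ℚ.* t)) (xb x)

isμ : ∀ {m} → V m → Bool
isμ x = is (resℤ (αI x) 4) 2 ∧ is (resℤ (γI x) 4) 2 ∧ allV (λ z → is (resℤ z 2) 1) (βI x)

in2 : ∀ {m} → V m → Bool
in2 x = is (resℤ (αI x) 2) 0 ∧ is (resℤ (γI x) 2) 0 ∧ allV (λ z → is (resℤ z 2) 0) (βI x)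

isZero : ∀ {m} → V m → Bool
isZero x = is (resℤ (αI x) 4) 0 ∧ is (resℤ (γI x) 4) 0 ∧ allV (λ z → is (resℤ z 2) 0) (βI x)

sgn : ∀ {m} → V m → ℤ
sgn x = if is (resℤ ((αI x ℤ.+ + 1) ℤ.* (γI x ℤ.+ + 1)) 2) 0 then + 1 else ℤ.- (+ 1)

-- sgn(λ/2) for λ ∈ 2(K'/K)
sgn2 : ∀ {m} → V m → ℤ
sgn2 x = if isZero x then ℤ.- (+ 1) else + 1

-- coefficient of q^n in f^m, g^m = f^m(τ/4), g^m_j, h_0^m
fmCoef : ℕ → ℚ → ℤ
fmCoef m n = coefAt (powS m fS) n

gmCoef : ℕ → ℚ → ℤ
gmCoef m n = coefAt (powS m fS) (ℕtoℚ 4 ℚ.* n)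

gmjCoef : ℕ → ℚ → ℚ → ℤ
gmjCoef m j n = if isInt (n ℚ.- j) then gmCoef m n else + 0

h0mCoef : ℕ → ℚ → ℤ
h0mCoef m n = coefAt (H0S m) (n ℚ.+ ℕtoℚ m ℚ.* recip (ℕtoℚ 4))

cF : (m : ℕ) → V m → ℚ → ℤ
cF m x n =
  ((if isμ x then h0mCoef m n else + 0)
   ℤ.+ (if in2 x then sgn2 x ℤ.* (+ (2 ℕ.^ (m ℕ.∸ 1))) ℤ.* fmCoef m n else + 0))
  ℤ.- sgn x ℤ.* (+ (2 ℕ.^ m)) ℤ.* gmjCoef m (Qf x) n

cFPN : (m : ℕ) → V m → ℚ → ℤ
cFPN m x n = if inK' x then cF m x n else + 0

-- Sums over (possibly infinite) index sets with finitely many nonzero terms: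
-- FinSum S f s  means  Σ_{x ∈ S} f x = s  (a duplicate-free list of
-- elements of S containing every x ∈ S with f x ≠ 0, summing to s).

record FinSum {X : Set} (S : X → Set) (f : X → ℤ) (s : ℤ) : Set where
  field
    support  : List X
    inS      : All S support
    distinct : Unique support
    complete : ∀ x → S x → f x ≢ + 0 → x ∈ support
    total    : sumℤ (List.map f support) ≡ s

Avec : ∀ {m} → ℕ → Vec ℤ m → ℕ → V m
Avec a b c = vec (ℕtoℚ a) (Vec.map ℤtoℚ b) (ℕtoℚ c)

Disc : ∀ {m} → ℕ → Vec ℤ m → ℕ → ℤ
Disc a b c = Vec.foldr _ (λ z r → z ℤ.* z ℤ.+ r) (+ 0) b ℤ.- + 4 ℤ.* + a ℤ.* + c

-- |D| as a rational (= Q(A) when D < 0)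
absD : ∀ {m} → ℕ → Vec ℤ m → ℕ → ℚ
absD a b c = ℤtoℚ (ℤ.- Disc a b c)

InN : ∀ {m} → V m → V m → Set
InN A x = InK x × bil x A ≡ ℚ.0ℚ

InN' : ∀ {m} → V m → V m → Set
InN' A x = bil x A ≡ ℚ.0ℚ × (∀ y → InN A y → IsInt (bil x y))

IsRepSys : ∀ {m} → V m → List (V m) → Set
IsRepSys A R =
  All (InN' A) R
  × AllPairs (λ r s → ¬ InN A (r ⊖ s)) R
  × (∀ x → InN' A x → ∃ λ r → r ∈ R × InN A (x ⊖ r))

-- element of P' representing h ∈ ℤ/2|D|ℤ:  (h / 2|D|) A
βh : ∀ {m} → ℕ → Vec ℤ m → ℕ → ℤ → V m
βh a b c h = (ℤtoℚ h ℚ.* recip (ℕtoℚ 2 ℚ.* absD a b c)) · Avec a b c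

-- c_A(h, ℓ) = s, computed from F_A = Σ_β (Σ_{α ∈ N'/N} F_{m,P⊕N,α+β} Θ_{N(-1),α}) e_β
-- with α running through the representative system R.  The coefficient of q^ℓ in
-- F_{m,P⊕N,α+β} · Σ_{x ∈ N+α} q^{-Q(x)} is Σ_{x ∈ N+α} c(α+β, ℓ + Q(x)).
CA : (m : ℕ) → ℕ → Vec ℤ m → ℕ → List (V m) → ℤ → ℚ → ℤ → Set
CA m a b c []      h ℓ s = s ≡ + 0
CA m a b c (r ∷ R) h ℓ s =
  Σ ℤ λ s₁ → Σ ℤ λ s₂ →
    FinSum (λ x → InN (Avec a b c) (x ⊖ r))
           (λ x → cFPN m (r ⊕ βh a b c h) (ℓ ℚ.+ Qf x)) s₁
    × CA m a b c R h ℓ s₂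
    × s ≡ s₁ ℤ.+ s₂

hSq : ∀ {m} → ℕ → Vec ℤ m → ℕ → ℤ → ℚ
hSq a b c h = ℤtoℚ (h ℤ.* h) ℚ.* recip (ℕtoℚ 4 ℚ.* absD a b c)

-- Put βₕ = (h / 2|D|) A, so that (βₕ, A) = h and Q(βₕ) = h²/4|D|. For x ⊥ A, translation by βₕ
-- gives (x + βₕ, A) = h and Q(x + βₕ) = Q(x) + h²/4|D|, and the coefficients of F_m in the
-- component λ + K depend only on λ + K. Hence the summand of c_A(h, ℓ) indexed by a representative
-- r of N'/N is the sum of c_{F_m}(λ, ℓ + Q(λ) − h²/4|D|) over those λ ∈ K' with (λ, A) = h and
-- λ − βₕ ∈ N + r, and every such λ has λ − βₕ ∈ N' in exactly one of these cosets. All sums are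
-- finite: a nonzero coefficient bounds 4Q(λ) from below, and since Q(A) = |D| > 0 the form −Q is
-- positive definite on A^⊥, which confines λ to a box.

{-# OPTIONS --safe #-}
module Submission where

open import Defs
open import Data.Nat using (ℕ; _≤_)
open import Data.Integer using (ℤ; _<_; +_)
open import Data.Rational using (ℚ; _+_; _-_)
open import Data.Vec using (Vec)
open import Data.List using (List)
open import Data.Product using (∃; _×_)
open import Relation.Binary.PropositionalEquality using (_≡_)

open import Data.Bool using (Bool; true; false; if_then_else_; _∧_)
open import Data.Empty using (⊥-elim)
open import Data.Product using (Σ; _,_; proj₁; proj₂)
open import Data.Sum using (_⊎_; inj₁; inj₂)
open import Level using (0ℓ)
open import Data.Nat as ℕ using (zero; suc)
import Data.Nat.Coprimality as Coprimality
import Data.Nat.Properties as ℕP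
import Data.Nat.Tactic.RingSolver as ℕSolver
open import Data.Integer as ℤ using (-[1+_])
import Data.Integer.DivMod as ℤD
import Data.Integer.Properties as ℤP
open import Data.Integer.Tactic.RingSolver using (solve-∀)
open import Data.Rational as ℚ using (mkℚ)
import Data.Rational.Properties as ℚP
open import Data.Vec as Vec using ([]; _∷_)
import Data.Vec.Properties as VecP
import Data.Vec.Relation.Unary.All as VAll
open VAll using ([]; _∷_)
open import Data.List as List using ([]; _∷_; _++_)
import Data.List.Properties as ListP
open import Data.List.Membership.Propositional using (_∈_)
open import Data.List.Membership.Propositional.Properties
open import Data.List.Relation.Unary.All as All using (All; []; _∷_)
import Data.List.Relation.Unary.All.Properties as AllP
open import Data.List.Relation.Unary.AllPairs as AllPairs using (AllPairs; []; _∷_)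
open import Data.List.Relation.Unary.Any using (Any; here; there)
open import Data.List.Relation.Unary.Unique.DecPropositional.Properties using (deduplicate-!)
open import Data.List.Relation.Unary.Unique.Propositional using (Unique)
import Data.List.Relation.Unary.Unique.Propositional.Properties as UniqueP
open import Relation.Binary.PropositionalEquality
open import Relation.Nullary using (Dec; yes; no; ¬_; does)
open import Relation.Nullary.Decidable using (dec-true; dec-false; dec⇒maybe; map′; _×-dec_; ¬?)
open import Relation.Unary using (Decidable)
import Tactic.RingSolver as RingSolver
import Tactic.RingSolver.Core.AlmostCommutativeRing as ACR

cong₃ : ∀ {A B C D : Set} (f : A → B → C → D) {a a' b b' c c'} →
        a ≡ a' → b ≡ b' → c ≡ c' → f a b c ≡ f a' b' c'
cong₃ f refl refl refl = refl

ℚ-ring : ACR.AlmostCommutativeRing 0ℓ 0ℓ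
ℚ-ring = ACR.fromCommutativeRing ℚP.+-*-commutativeRing (λ x → dec⇒maybe (ℚ.0ℚ ℚP.≟ x))

ℤtoℚ≡mkℚ : ∀ z → ℤtoℚ z ≡ mkℚ z 0 (Coprimality.sym (Coprimality.1-coprimeTo ℤ.∣ z ∣))
ℤtoℚ≡mkℚ z = ℚP.↥p/↧p≡p (mkℚ z 0 (Coprimality.sym (Coprimality.1-coprimeTo ℤ.∣ z ∣)))

ℤtoℚ-homo-+ : ∀ z w → ℤtoℚ (z ℤ.+ w) ≡ ℤtoℚ z ℚ.+ ℤtoℚ w
ℤtoℚ-homo-+ z w rewrite ℤtoℚ≡mkℚ z | ℤtoℚ≡mkℚ w =
  sym (cong (ℚ._/ 1) (cong₂ ℤ._+_ (ℤP.*-identityʳ z) (ℤP.*-identityʳ w)))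

ℤtoℚ-homo-* : ∀ z w → ℤtoℚ (z ℤ.* w) ≡ ℤtoℚ z ℚ.* ℤtoℚ w
ℤtoℚ-homo-* z w rewrite ℤtoℚ≡mkℚ z | ℤtoℚ≡mkℚ w = refl

ℤtoℚ-homo-neg : ∀ z → ℤtoℚ (ℤ.- z) ≡ ℚ.- ℤtoℚ z
ℤtoℚ-homo-neg z rewrite ℤtoℚ≡mkℚ z | ℤtoℚ≡mkℚ (ℤ.- z) = mkℚ-neg z
  where
  mkℚ-neg : ∀ z → mkℚ (ℤ.- z) 0 (Coprimality.sym (Coprimality.1-coprimeTo ℤ.∣ ℤ.- z ∣))
                  ≡ ℚ.- mkℚ z 0 (Coprimality.sym (Coprimality.1-coprimeTo ℤ.∣ z ∣))
  mkℚ-neg (+ zero)  = refl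
  mkℚ-neg (+ suc n) = refl
  mkℚ-neg -[1+ n ]  = refl

ℤtoℚ-homo-sub : ∀ z w → ℤtoℚ (z ℤ.- w) ≡ ℤtoℚ z ℚ.- ℤtoℚ w
ℤtoℚ-homo-sub z w = trans (ℤtoℚ-homo-+ z (ℤ.- w)) (cong (ℤtoℚ z ℚ.+_) (ℤtoℚ-homo-neg w))

↥-ℤtoℚ : ∀ z → ℚ.↥ (ℤtoℚ z) ≡ z
↥-ℤtoℚ z rewrite ℤtoℚ≡mkℚ z = refl

ℤtoℚ-injective : ∀ {z w} → ℤtoℚ z ≡ ℤtoℚ w → z ≡ w
ℤtoℚ-injective {z} {w} e = trans (sym (↥-ℤtoℚ z)) (trans (cong ℚ.↥_ e) (↥-ℤtoℚ w))

IsInt-ℤtoℚ : ∀ z → IsInt (ℤtoℚ z)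
IsInt-ℤtoℚ z rewrite ℤtoℚ≡mkℚ z = refl

IsInt⇒≡ℤtoℚ↥ : ∀ p → IsInt p → p ≡ ℤtoℚ (ℚ.↥ p)
IsInt⇒≡ℤtoℚ↥ (mkℚ n zero _) refl = sym (ℤtoℚ≡mkℚ n)

IsInt-≡ℤtoℚ : ∀ {p} z → ℤtoℚ z ≡ p → IsInt p
IsInt-≡ℤtoℚ z e = subst IsInt e (IsInt-ℤtoℚ z)

IsInt-+ : ∀ p q → IsInt p → IsInt q → IsInt (p ℚ.+ q)
IsInt-+ p q ip iq = IsInt-≡ℤtoℚ (ℚ.↥ p ℤ.+ ℚ.↥ q)
  (trans (ℤtoℚ-homo-+ (ℚ.↥ p) (ℚ.↥ q))
         (sym (cong₂ ℚ._+_ (IsInt⇒≡ℤtoℚ↥ p ip) (IsInt⇒≡ℤtoℚ↥ q iq))))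

IsInt-* : ∀ p q → IsInt p → IsInt q → IsInt (p ℚ.* q)
IsInt-* p q ip iq = IsInt-≡ℤtoℚ (ℚ.↥ p ℤ.* ℚ.↥ q)
  (trans (ℤtoℚ-homo-* (ℚ.↥ p) (ℚ.↥ q))
         (sym (cong₂ ℚ._*_ (IsInt⇒≡ℤtoℚ↥ p ip) (IsInt⇒≡ℤtoℚ↥ q iq))))

IsInt-neg : ∀ p → IsInt p → IsInt (ℚ.- p)
IsInt-neg p ip = IsInt-≡ℤtoℚ (ℤ.- ℚ.↥ p)
  (trans (ℤtoℚ-homo-neg (ℚ.↥ p)) (sym (cong ℚ.-_ (IsInt⇒≡ℤtoℚ↥ p ip))))

IsInt-sub : ∀ p q → IsInt p → IsInt q → IsInt (p ℚ.- q)
IsInt-sub p q ip iq = IsInt-+ p (ℚ.- q) ip (IsInt-neg q iq)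

IsInt? : ∀ p → Dec (IsInt p)
IsInt? p = ℚ.denominatorℕ p ℕ.≟ 1

IsInt⇒isInt≡true : ∀ p → IsInt p → isInt p ≡ true
IsInt⇒isInt≡true p = dec-true (IsInt? p)

isInt≡true⇒IsInt : ∀ p → isInt p ≡ true → IsInt p
isInt≡true⇒IsInt p = from-does (IsInt? p)
  where
  from-does : ∀ {A : Set} (a? : Dec A) → does a? ≡ true → A
  from-does (yes a) _ = a

isInt-+-integer : ∀ p i → IsInt i → isInt (p ℚ.+ i) ≡ isInt p
isInt-+-integer p i ii with IsInt? p
... | yes ip = trans (IsInt⇒isInt≡true (p ℚ.+ i) (IsInt-+ p i ip ii)) (sym (IsInt⇒isInt≡true p ip))
... | no ¬ip = trans (dec-false (IsInt? (p ℚ.+ i)) ¬ipi) (sym (dec-false (IsInt? p) ¬ip))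
  where
  cancel : ∀ (p i : ℚ) → (p ℚ.+ i) ℚ.- i ≡ p
  cancel = RingSolver.solve-∀ ℚ-ring
  ¬ipi : ¬ IsInt (p ℚ.+ i)
  ¬ipi ipi = ¬ip (subst IsInt (cancel p i) (IsInt-sub (p ℚ.+ i) i ipi ii))

¼ ½ : ℚ
¼ = + 1 ℚ./ 4
½ = + 1 ℚ./ 2

dot : ∀ {m} → Vec ℚ m → Vec ℚ m → ℚ
dot u v = sumℚ (Vec.zipWith ℚ._*_ u v)

normSq : ∀ {m} → Vec ℚ m → ℚ
normSq u = sumℚ (Vec.map (λ x → x ℚ.* x) u)

dot-+ˡ : ∀ {m} (u v w : Vec ℚ m) → dot (Vec.zipWith ℚ._+_ u v) w ≡ dot u w ℚ.+ dot v w
dot-+ˡ [] [] [] = refl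
dot-+ˡ (x ∷ u) (y ∷ v) (z ∷ w) =
  trans (cong ((x ℚ.+ y) ℚ.* z ℚ.+_) (dot-+ˡ u v w)) (ring x y z (dot u w) (dot v w))
  where
  ring : ∀ (x y z s t : ℚ) → (x ℚ.+ y) ℚ.* z ℚ.+ (s ℚ.+ t) ≡ (x ℚ.* z ℚ.+ s) ℚ.+ (y ℚ.* z ℚ.+ t)
  ring = RingSolver.solve-∀ ℚ-ring

dot-subˡ : ∀ {m} (u v w : Vec ℚ m) → dot (Vec.zipWith ℚ._-_ u v) w ≡ dot u w ℚ.- dot v w
dot-subˡ [] [] [] = refl
dot-subˡ (x ∷ u) (y ∷ v) (z ∷ w) =
  trans (cong ((x ℚ.- y) ℚ.* z ℚ.+_) (dot-subˡ u v w)) (ring x y z (dot u w) (dot v w))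
  where
  ring : ∀ (x y z s t : ℚ) → (x ℚ.- y) ℚ.* z ℚ.+ (s ℚ.- t) ≡ (x ℚ.* z ℚ.+ s) ℚ.- (y ℚ.* z ℚ.+ t)
  ring = RingSolver.solve-∀ ℚ-ring

dot-*ˡ : ∀ {m} (t : ℚ) (u v : Vec ℚ m) → dot (Vec.map (t ℚ.*_) u) v ≡ t ℚ.* dot u v
dot-*ˡ t [] [] = sym (ℚP.*-zeroʳ t)
dot-*ˡ t (x ∷ u) (y ∷ v) = trans (cong (t ℚ.* x ℚ.* y ℚ.+_) (dot-*ˡ t u v)) (ring t x y (dot u v))
  where
  ring : ∀ (t x y s : ℚ) → t ℚ.* x ℚ.* y ℚ.+ t ℚ.* s ≡ t ℚ.* (x ℚ.* y ℚ.+ s)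
  ring = RingSolver.solve-∀ ℚ-ring

dot-comm : ∀ {m} (u v : Vec ℚ m) → dot u v ≡ dot v u
dot-comm [] [] = refl
dot-comm (x ∷ u) (y ∷ v) = cong₂ ℚ._+_ (ℚP.*-comm x y) (dot-comm u v)

dot-self : ∀ {m} (u : Vec ℚ m) → dot u u ≡ normSq u
dot-self [] = refl
dot-self (x ∷ u) = cong (x ℚ.* x ℚ.+_) (dot-self u)

normSq-+ : ∀ {m} (u v : Vec ℚ m) →
           normSq (Vec.zipWith ℚ._+_ u v) ≡ normSq u ℚ.+ normSq v ℚ.+ ℕtoℚ 2 ℚ.* dot u v
normSq-+ [] [] = refl
normSq-+ (x ∷ u) (y ∷ v) =
  trans (cong ((x ℚ.+ y) ℚ.* (x ℚ.+ y) ℚ.+_) (normSq-+ u v)) (ring x y (normSq u) (normSq v) (dot u v))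
  where
  ring : ∀ (x y a b c : ℚ) → (x ℚ.+ y) ℚ.* (x ℚ.+ y) ℚ.+ (a ℚ.+ b ℚ.+ ℕtoℚ 2 ℚ.* c)
         ≡ (x ℚ.* x ℚ.+ a) ℚ.+ (y ℚ.* y ℚ.+ b) ℚ.+ ℕtoℚ 2 ℚ.* (x ℚ.* y ℚ.+ c)
  ring = RingSolver.solve-∀ ℚ-ring

normSq-* : ∀ {m} (t : ℚ) (u : Vec ℚ m) → normSq (Vec.map (t ℚ.*_) u) ≡ t ℚ.* t ℚ.* normSq u
normSq-* t [] = sym (ℚP.*-zeroʳ (t ℚ.* t))
normSq-* t (x ∷ u) = trans (cong (t ℚ.* x ℚ.* (t ℚ.* x) ℚ.+_) (normSq-* t u)) (ring t x (normSq u))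
  where
  ring : ∀ (t x s : ℚ) → t ℚ.* x ℚ.* (t ℚ.* x) ℚ.+ t ℚ.* t ℚ.* s ≡ t ℚ.* t ℚ.* (x ℚ.* x ℚ.+ s)
  ring = RingSolver.solve-∀ ℚ-ring

bil-⊕ˡ : ∀ {m} (u v w : V m) → bil (u ⊕ v) w ≡ bil u w ℚ.+ bil v w
bil-⊕ˡ (vec a b c) (vec a' b' c') (vec a'' b'' c'') =
  trans (cong (λ s → ℕtoℚ 4 ℚ.* ((a ℚ.+ a') ℚ.* c'' ℚ.+ (c ℚ.+ c') ℚ.* a'') ℚ.- ℕtoℚ 2 ℚ.* s)
              (dot-+ˡ b b' b''))
        (ring a c a' c' a'' c'' (dot b b'') (dot b' b''))
  where
  ring : ∀ (a c a' c' a'' c'' s t : ℚ) →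
         ℕtoℚ 4 ℚ.* ((a ℚ.+ a') ℚ.* c'' ℚ.+ (c ℚ.+ c') ℚ.* a'') ℚ.- ℕtoℚ 2 ℚ.* (s ℚ.+ t)
         ≡ (ℕtoℚ 4 ℚ.* (a ℚ.* c'' ℚ.+ c ℚ.* a'') ℚ.- ℕtoℚ 2 ℚ.* s)
           ℚ.+ (ℕtoℚ 4 ℚ.* (a' ℚ.* c'' ℚ.+ c' ℚ.* a'') ℚ.- ℕtoℚ 2 ℚ.* t)
  ring = RingSolver.solve-∀ ℚ-ring

bil-⊖ˡ : ∀ {m} (u v w : V m) → bil (u ⊖ v) w ≡ bil u w ℚ.- bil v w
bil-⊖ˡ (vec a b c) (vec a' b' c') (vec a'' b'' c'') =
  trans (cong (λ s → ℕtoℚ 4 ℚ.* ((a ℚ.- a') ℚ.* c'' ℚ.+ (c ℚ.- c') ℚ.* a'') ℚ.- ℕtoℚ 2 ℚ.* s)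
              (dot-subˡ b b' b''))
        (ring a c a' c' a'' c'' (dot b b'') (dot b' b''))
  where
  ring : ∀ (a c a' c' a'' c'' s t : ℚ) →
         ℕtoℚ 4 ℚ.* ((a ℚ.- a') ℚ.* c'' ℚ.+ (c ℚ.- c') ℚ.* a'') ℚ.- ℕtoℚ 2 ℚ.* (s ℚ.- t)
         ≡ (ℕtoℚ 4 ℚ.* (a ℚ.* c'' ℚ.+ c ℚ.* a'') ℚ.- ℕtoℚ 2 ℚ.* s)
           ℚ.- (ℕtoℚ 4 ℚ.* (a' ℚ.* c'' ℚ.+ c' ℚ.* a'') ℚ.- ℕtoℚ 2 ℚ.* t)
  ring = RingSolver.solve-∀ ℚ-ring

bil-·ˡ : ∀ {m} (t : ℚ) (u v : V m) → bil (t · u) v ≡ t ℚ.* bil u v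
bil-·ˡ t (vec a b c) (vec a' b' c') =
  trans (cong (λ s → ℕtoℚ 4 ℚ.* (t ℚ.* a ℚ.* c' ℚ.+ t ℚ.* c ℚ.* a') ℚ.- ℕtoℚ 2 ℚ.* s) (dot-*ˡ t b b'))
        (ring t a c a' c' (dot b b'))
  where
  ring : ∀ (t a c a' c' s : ℚ) →
         ℕtoℚ 4 ℚ.* (t ℚ.* a ℚ.* c' ℚ.+ t ℚ.* c ℚ.* a') ℚ.- ℕtoℚ 2 ℚ.* (t ℚ.* s)
         ≡ t ℚ.* (ℕtoℚ 4 ℚ.* (a ℚ.* c' ℚ.+ c ℚ.* a') ℚ.- ℕtoℚ 2 ℚ.* s)
  ring = RingSolver.solve-∀ ℚ-ring

bil-comm : ∀ {m} (u v : V m) → bil u v ≡ bil v u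
bil-comm (vec a b c) (vec a' b' c') =
  trans (cong (λ s → ℕtoℚ 4 ℚ.* (a ℚ.* c' ℚ.+ c ℚ.* a') ℚ.- ℕtoℚ 2 ℚ.* s) (dot-comm b b'))
        (ring a c a' c' (dot b' b))
  where
  ring : ∀ (a c a' c' s : ℚ) →
         ℕtoℚ 4 ℚ.* (a ℚ.* c' ℚ.+ c ℚ.* a') ℚ.- ℕtoℚ 2 ℚ.* s
         ≡ ℕtoℚ 4 ℚ.* (a' ℚ.* c ℚ.+ c' ℚ.* a) ℚ.- ℕtoℚ 2 ℚ.* s
  ring = RingSolver.solve-∀ ℚ-ring

bil-self : ∀ {m} (u : V m) → bil u u ≡ Qf u ℚ.+ Qf u
bil-self (vec a b c) =
  trans (cong (λ s → ℕtoℚ 4 ℚ.* (a ℚ.* c ℚ.+ c ℚ.* a) ℚ.- ℕtoℚ 2 ℚ.* s) (dot-self b))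
        (ring a c (normSq b))
  where
  ring : ∀ (a c s : ℚ) →
         ℕtoℚ 4 ℚ.* (a ℚ.* c ℚ.+ c ℚ.* a) ℚ.- ℕtoℚ 2 ℚ.* s
         ≡ (ℕtoℚ 4 ℚ.* a ℚ.* c ℚ.- s) ℚ.+ (ℕtoℚ 4 ℚ.* a ℚ.* c ℚ.- s)
  ring = RingSolver.solve-∀ ℚ-ring

Qf-⊕ : ∀ {m} (u v : V m) → Qf (u ⊕ v) ≡ Qf u ℚ.+ Qf v ℚ.+ bil u v
Qf-⊕ (vec a b c) (vec a' b' c') =
  trans (cong (ℚ._-_ (ℕtoℚ 4 ℚ.* (a ℚ.+ a') ℚ.* (c ℚ.+ c'))) (normSq-+ b b'))
        (ring a c a' c' (normSq b) (normSq b') (dot b b'))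
  where
  ring : ∀ (a c a' c' s t w : ℚ) →
         ℕtoℚ 4 ℚ.* (a ℚ.+ a') ℚ.* (c ℚ.+ c') ℚ.- (s ℚ.+ t ℚ.+ ℕtoℚ 2 ℚ.* w)
         ≡ (ℕtoℚ 4 ℚ.* a ℚ.* c ℚ.- s) ℚ.+ (ℕtoℚ 4 ℚ.* a' ℚ.* c' ℚ.- t)
           ℚ.+ (ℕtoℚ 4 ℚ.* (a ℚ.* c' ℚ.+ c ℚ.* a') ℚ.- ℕtoℚ 2 ℚ.* w)
  ring = RingSolver.solve-∀ ℚ-ring

Qf-· : ∀ {m} (t : ℚ) (u : V m) → Qf (t · u) ≡ t ℚ.* t ℚ.* Qf u
Qf-· t (vec a b c) =
  trans (cong (ℚ._-_ (ℕtoℚ 4 ℚ.* (t ℚ.* a) ℚ.* (t ℚ.* c))) (normSq-* t b)) (ring t a c (normSq b))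
  where
  ring : ∀ (t a c s : ℚ) →
         ℕtoℚ 4 ℚ.* (t ℚ.* a) ℚ.* (t ℚ.* c) ℚ.- t ℚ.* t ℚ.* s ≡ t ℚ.* t ℚ.* (ℕtoℚ 4 ℚ.* a ℚ.* c ℚ.- s)
  ring = RingSolver.solve-∀ ℚ-ring

x⊖t⊕t≡x : ∀ {m} (x t : V m) → (x ⊖ t) ⊕ t ≡ x
x⊖t⊕t≡x (vec a b c) (vec a' b' c') = cong₃ vec (ring a a') (coords b b') (ring c c')
  where
  ring : ∀ (x y : ℚ) → (x ℚ.- y) ℚ.+ y ≡ x
  ring = RingSolver.solve-∀ ℚ-ring
  coords : ∀ {m} (u v : Vec ℚ m) → Vec.zipWith ℚ._+_ (Vec.zipWith ℚ._-_ u v) v ≡ u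
  coords [] [] = refl
  coords (x ∷ u) (y ∷ v) = cong₂ _∷_ (ring x y) (coords u v)

x⊕t⊖t≡x : ∀ {m} (x t : V m) → (x ⊕ t) ⊖ t ≡ x
x⊕t⊖t≡x (vec a b c) (vec a' b' c') = cong₃ vec (ring a a') (coords b b') (ring c c')
  where
  ring : ∀ (x y : ℚ) → (x ℚ.+ y) ℚ.- y ≡ x
  ring = RingSolver.solve-∀ ℚ-ring
  coords : ∀ {m} (u v : Vec ℚ m) → Vec.zipWith ℚ._-_ (Vec.zipWith ℚ._+_ u v) v ≡ u
  coords [] [] = refl
  coords (x ∷ u) (y ∷ v) = cong₂ _∷_ (ring x y) (coords u v)

x⊕t≡[r⊕t]⊕[x⊖r] : ∀ {m} (x t r : V m) → x ⊕ t ≡ (r ⊕ t) ⊕ (x ⊖ r)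
x⊕t≡[r⊕t]⊕[x⊖r] (vec a b c) (vec a' b' c') (vec a'' b'' c'') =
  cong₃ vec (ring a a' a'') (coords b b' b'') (ring c c' c'')
  where
  ring : ∀ (x t r : ℚ) → x ℚ.+ t ≡ (r ℚ.+ t) ℚ.+ (x ℚ.- r)
  ring = RingSolver.solve-∀ ℚ-ring
  coords : ∀ {m} (u v w : Vec ℚ m) →
           Vec.zipWith ℚ._+_ u v ≡ Vec.zipWith ℚ._+_ (Vec.zipWith ℚ._+_ w v) (Vec.zipWith ℚ._-_ u w)
  coords [] [] [] = refl
  coords (x ∷ u) (y ∷ v) (z ∷ w) = cong₂ _∷_ (ring x y z) (coords u v w)

r⊕t≡[x⊕t]⊖[x⊖r] : ∀ {m} (x t r : V m) → r ⊕ t ≡ (x ⊕ t) ⊖ (x ⊖ r)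
r⊕t≡[x⊕t]⊖[x⊖r] (vec a b c) (vec a' b' c') (vec a'' b'' c'') =
  cong₃ vec (ring a a' a'') (coords b b' b'') (ring c c' c'')
  where
  ring : ∀ (x t r : ℚ) → r ℚ.+ t ≡ (x ℚ.+ t) ℚ.- (x ℚ.- r)
  ring = RingSolver.solve-∀ ℚ-ring
  coords : ∀ {m} (u v w : Vec ℚ m) →
           Vec.zipWith ℚ._+_ w v ≡ Vec.zipWith ℚ._-_ (Vec.zipWith ℚ._+_ u v) (Vec.zipWith ℚ._-_ u w)
  coords [] [] [] = refl
  coords (x ∷ u) (y ∷ v) (z ∷ w) = cong₂ _∷_ (ring x y z) (coords u v w)

r⊖s≡[x⊖s]⊖[x⊖r] : ∀ {m} (x r s : V m) → r ⊖ s ≡ (x ⊖ s) ⊖ (x ⊖ r)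
r⊖s≡[x⊖s]⊖[x⊖r] (vec a b c) (vec a' b' c') (vec a'' b'' c'') =
  cong₃ vec (ring a a' a'') (coords b b' b'') (ring c c' c'')
  where
  ring : ∀ (x r s : ℚ) → r ℚ.- s ≡ (x ℚ.- s) ℚ.- (x ℚ.- r)
  ring = RingSolver.solve-∀ ℚ-ring
  coords : ∀ {m} (u v w : Vec ℚ m) →
           Vec.zipWith ℚ._-_ v w ≡ Vec.zipWith ℚ._-_ (Vec.zipWith ℚ._-_ u w) (Vec.zipWith ℚ._-_ u v)
  coords [] [] [] = refl
  coords (x ∷ u) (y ∷ v) (z ∷ w) = cong₂ _∷_ (ring x y z) (coords u v w)

⊖-cancelʳ-≡ : ∀ {m} {x y : V m} (t : V m) → x ⊖ t ≡ y ⊖ t → x ≡ y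
⊖-cancelʳ-≡ {x = x} {y} t e = trans (sym (x⊖t⊕t≡x x t)) (trans (cong (_⊕ t) e) (x⊖t⊕t≡x y t))

All-IsInt-zipWith : ∀ {m} (_∙_ : ℚ → ℚ → ℚ) → (∀ p q → IsInt p → IsInt q → IsInt (p ∙ q)) →
                    (u v : Vec ℚ m) → VAll.All IsInt u → VAll.All IsInt v →
                    VAll.All IsInt (Vec.zipWith _∙_ u v)
All-IsInt-zipWith _∙_ closed [] [] [] [] = []
All-IsInt-zipWith _∙_ closed (x ∷ u) (y ∷ v) (ix ∷ iu) (iy ∷ iv) =
  closed x y ix iy ∷ All-IsInt-zipWith _∙_ closed u v iu iv

IsInt-sumℚ : ∀ {m} (u : Vec ℚ m) → VAll.All IsInt u → IsInt (sumℚ u)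
IsInt-sumℚ [] [] = refl
IsInt-sumℚ (x ∷ u) (ix ∷ iu) = IsInt-+ x (sumℚ u) ix (IsInt-sumℚ u iu)

InK-⊕ : ∀ {m} (u v : V m) → InK u → InK v → InK (u ⊕ v)
InK-⊕ (vec a b c) (vec a' b' c') (ia , ib , ic) (ia' , ib' , ic') =
  IsInt-+ a a' ia ia' , All-IsInt-zipWith ℚ._+_ IsInt-+ b b' ib ib' , IsInt-+ c c' ic ic'

InK-⊖ : ∀ {m} (u v : V m) → InK u → InK v → InK (u ⊖ v)
InK-⊖ (vec a b c) (vec a' b' c') (ia , ib , ic) (ia' , ib' , ic') =
  IsInt-sub a a' ia ia' , All-IsInt-zipWith ℚ._-_ IsInt-sub b b' ib ib' , IsInt-sub c c' ic ic'

-- InK' x unfolds to InK (dualScale x).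
dualScale : ∀ {m} → V m → V m
dualScale (vec a b c) = vec (ℕtoℚ 4 ℚ.* a) (Vec.map (ℕtoℚ 2 ℚ.*_) b) (ℕtoℚ 4 ℚ.* c)

InK-dualScale : ∀ {m} (k : V m) → InK k → InK (dualScale k)
InK-dualScale (vec a b c) (ia , ib , ic) =
  IsInt-* (ℕtoℚ 4) a refl ia , coords b ib , IsInt-* (ℕtoℚ 4) c refl ic
  where
  coords : ∀ {m} (u : Vec ℚ m) → VAll.All IsInt u → VAll.All IsInt (Vec.map (ℕtoℚ 2 ℚ.*_) u)
  coords [] [] = []
  coords (x ∷ u) (ix ∷ iu) = IsInt-* (ℕtoℚ 2) x refl ix ∷ coords u iu

dualScale-⊕ : ∀ {m} (u v : V m) → dualScale (u ⊕ v) ≡ dualScale u ⊕ dualScale v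
dualScale-⊕ (vec a b c) (vec a' b' c') = cong₃ vec (ring (ℕtoℚ 4) a a') (coords b b') (ring (ℕtoℚ 4) c c')
  where
  ring : ∀ (k x y : ℚ) → k ℚ.* (x ℚ.+ y) ≡ k ℚ.* x ℚ.+ k ℚ.* y
  ring = RingSolver.solve-∀ ℚ-ring
  coords : ∀ {m} (u v : Vec ℚ m) → Vec.map (ℕtoℚ 2 ℚ.*_) (Vec.zipWith ℚ._+_ u v)
                                   ≡ Vec.zipWith ℚ._+_ (Vec.map (ℕtoℚ 2 ℚ.*_) u) (Vec.map (ℕtoℚ 2 ℚ.*_) v)
  coords [] [] = refl
  coords (x ∷ u) (y ∷ v) = cong₂ _∷_ (ring (ℕtoℚ 2) x y) (coords u v)

dualScale-⊖ : ∀ {m} (u v : V m) → dualScale (u ⊖ v) ≡ dualScale u ⊖ dualScale v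
dualScale-⊖ (vec a b c) (vec a' b' c') = cong₃ vec (ring (ℕtoℚ 4) a a') (coords b b') (ring (ℕtoℚ 4) c c')
  where
  ring : ∀ (k x y : ℚ) → k ℚ.* (x ℚ.- y) ≡ k ℚ.* x ℚ.- k ℚ.* y
  ring = RingSolver.solve-∀ ℚ-ring
  coords : ∀ {m} (u v : Vec ℚ m) → Vec.map (ℕtoℚ 2 ℚ.*_) (Vec.zipWith ℚ._-_ u v)
                                   ≡ Vec.zipWith ℚ._-_ (Vec.map (ℕtoℚ 2 ℚ.*_) u) (Vec.map (ℕtoℚ 2 ℚ.*_) v)
  coords [] [] = refl
  coords (x ∷ u) (y ∷ v) = cong₂ _∷_ (ring (ℕtoℚ 2) x y) (coords u v)

InK'-⊕ : ∀ {m} (u k : V m) → InK' u → InK k → InK' (u ⊕ k)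
InK'-⊕ u k iu ik =
  subst InK (sym (dualScale-⊕ u k)) (InK-⊕ (dualScale u) (dualScale k) iu (InK-dualScale k ik))

InK'-⊖ : ∀ {m} (u k : V m) → InK' u → InK k → InK' (u ⊖ k)
InK'-⊖ u k iu ik =
  subst InK (sym (dualScale-⊖ u k)) (InK-⊖ (dualScale u) (dualScale k) iu (InK-dualScale k ik))

IsInt-bil : ∀ {m} (u k : V m) → InK' u → InK k → IsInt (bil u k)
IsInt-bil (vec a b c) (vec a' b' c') (ia , ib , ic) (ia' , ib' , ic') =
  subst IsInt (sym regroup)
    (IsInt-sub (4a ℚ.* c' ℚ.+ 4c ℚ.* a') (dot 2b b')
      (IsInt-+ (4a ℚ.* c') (4c ℚ.* a') (IsInt-* 4a c' ia ic') (IsInt-* 4c a' ic ia'))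
      (IsInt-sumℚ (Vec.zipWith ℚ._*_ 2b b') (All-IsInt-zipWith ℚ._*_ IsInt-* 2b b' ib ib')))
  where
  4a = ℕtoℚ 4 ℚ.* a
  4c = ℕtoℚ 4 ℚ.* c
  2b = Vec.map (ℕtoℚ 2 ℚ.*_) b
  ring : ∀ (a c a' c' s : ℚ) →
         ℕtoℚ 4 ℚ.* (a ℚ.* c' ℚ.+ c ℚ.* a') ℚ.- s ≡ (ℕtoℚ 4 ℚ.* a) ℚ.* c' ℚ.+ (ℕtoℚ 4 ℚ.* c) ℚ.* a' ℚ.- s
  ring = RingSolver.solve-∀ ℚ-ring
  regroup : bil (vec a b c) (vec a' b' c')
            ≡ 4a ℚ.* c' ℚ.+ 4c ℚ.* a' ℚ.- dot 2b b'
  regroup = trans (cong (ℚ._-_ (ℕtoℚ 4 ℚ.* (a ℚ.* c' ℚ.+ c ℚ.* a'))) (sym (dot-*ˡ (ℕtoℚ 2) b b')))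
                  (ring a c a' c' (dot 2b b'))

IsInt-Qf : ∀ {m} (k : V m) → InK k → IsInt (Qf k)
IsInt-Qf (vec a b c) (ia , ib , ic) =
  IsInt-sub (ℕtoℚ 4 ℚ.* a ℚ.* c) (normSq b)
    (IsInt-* (ℕtoℚ 4 ℚ.* a) c (IsInt-* (ℕtoℚ 4) a refl ia) ic) (IsInt-sumℚ _ (squares b ib))
  where
  squares : ∀ {m} (u : Vec ℚ m) → VAll.All IsInt u → VAll.All IsInt (Vec.map (λ x → x ℚ.* x) u)
  squares [] [] = []
  squares (x ∷ u) (ix ∷ iu) = IsInt-* x x ix ix ∷ squares u iu

InK? : ∀ {m} (u : V m) → Dec (InK u)
InK? (vec a b c) = IsInt? a ×-dec (VAll.all? IsInt? b ×-dec IsInt? c)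

InN? : ∀ {m} (A u : V m) → Dec (InN A u)
InN? A u = InK? u ×-dec (bil u A ℚP.≟ ℚ.0ℚ)

InN-⊖ : ∀ {m} (A u v : V m) → InN A u → InN A v → InN A (u ⊖ v)
InN-⊖ A u v (ku , u⊥A) (kv , v⊥A) =
  InK-⊖ u v ku kv , trans (bil-⊖ˡ u v A) (cong₂ ℚ._-_ u⊥A v⊥A)

-- The coefficients of F_m depend only on λ + K

remainder-unique : ∀ (d r r' : ℕ) (q q' : ℤ) → r ℕ.< d → r' ℕ.< d →
                   + r ℤ.+ q ℤ.* + d ≡ + r' ℤ.+ q' ℤ.* + d → r ≡ r'
remainder-unique d r r' q q' r<d r'<d eq = fromGap (q ℤ.- q') gap
  where
  gap : + r' ≡ + r ℤ.+ (q ℤ.- q') ℤ.* + d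
  gap = begin
    + r'                                  ≡⟨ ring₁ (+ r') q' (+ d) ⟩
    (+ r' ℤ.+ q' ℤ.* + d) ℤ.- q' ℤ.* + d  ≡⟨ cong (ℤ._- q' ℤ.* + d) (sym eq) ⟩
    (+ r ℤ.+ q ℤ.* + d) ℤ.- q' ℤ.* + d    ≡⟨ ring₂ (+ r) q q' (+ d) ⟩
    + r ℤ.+ (q ℤ.- q') ℤ.* + d            ∎
    where
    open ≡-Reasoning
    ring₁ : ∀ x q d → x ≡ (x ℤ.+ q ℤ.* d) ℤ.- q ℤ.* d
    ring₁ = solve-∀
    ring₂ : ∀ x q q' d → (x ℤ.+ q ℤ.* d) ℤ.- q' ℤ.* d ≡ x ℤ.+ (q ℤ.- q') ℤ.* d
    ring₂ = solve-∀
  noPositiveGap : ∀ s s' n → s' ℕ.< d → + s' ≢ + s ℤ.+ + suc n ℤ.* + d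
  noPositiveGap s s' n s'<d g = ℕP.<⇒≱ s'<d (ℕP.≤-trans d≤ (ℕP.≤-reflexive (sym (ℤP.+-injective g'))))
    where
    g' : + s' ≡ + (s ℕ.+ suc n ℕ.* d)
    g' = trans g (trans (cong (ℤ._+_ (+ s)) (sym (ℤP.pos-* (suc n) d))) (sym (ℤP.pos-+ s (suc n ℕ.* d))))
    d≤ : d ℕ.≤ s ℕ.+ suc n ℕ.* d
    d≤ = ℕP.≤-trans (ℕP.m≤m+n d (n ℕ.* d)) (ℕP.m≤n+m (suc n ℕ.* d) s)
  swap : ∀ x y e d → x ≡ y ℤ.+ e ℤ.* d → y ≡ x ℤ.+ (ℤ.- e) ℤ.* d
  swap x y e d refl = ring y e d
    where
    ring : ∀ y e d → y ≡ (y ℤ.+ e ℤ.* d) ℤ.+ (ℤ.- e) ℤ.* d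
    ring = solve-∀
  fromGap : ∀ e → + r' ≡ + r ℤ.+ e ℤ.* + d → r ≡ r'
  fromGap (+ zero) g = ℤP.+-injective (sym (trans g (ℤP.+-identityʳ (+ r))))
  fromGap (+ suc n) g = ⊥-elim (noPositiveGap r r' n r'<d g)
  fromGap -[1+ n ] g = ⊥-elim (noPositiveGap r' r n r<d (swap (+ r') (+ r) -[1+ n ] (+ d) g))

resℤ-+-multiple : ∀ (d : ℕ) .{{_ : ℕ.NonZero d}} (z w : ℤ) → resℤ (z ℤ.+ + d ℤ.* w) d ≡ resℤ z d
resℤ-+-multiple d z w =
  remainder-unique d _ _ ((z ℤ.+ + d ℤ.* w) ℤ./ℕ d) (z ℤ./ℕ d ℤ.+ w)
    (ℤD.n%ℕd<d (z ℤ.+ + d ℤ.* w) d) (ℤD.n%ℕd<d z d)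
    (trans (sym (ℤD.a≡a%ℕn+[a/ℕn]*n (z ℤ.+ + d ℤ.* w) d))
           (trans (cong (ℤ._+ + d ℤ.* w) (ℤD.a≡a%ℕn+[a/ℕn]*n z d)) (ring (+ resℤ z d) (z ℤ./ℕ d) (+ d) w)))
  where
  ring : ∀ r q d w → r ℤ.+ q ℤ.* d ℤ.+ d ℤ.* w ≡ r ℤ.+ (q ℤ.+ w) ℤ.* d
  ring = solve-∀

resℤ2-+4* : ∀ z w → resℤ (z ℤ.+ + 4 ℤ.* w) 2 ≡ resℤ z 2
resℤ2-+4* z w = trans (cong (λ t → resℤ t 2) (ring z w)) (resℤ-+-multiple 2 z (+ 2 ℤ.* w))
  where
  ring : ∀ z w → z ℤ.+ + 4 ℤ.* w ≡ z ℤ.+ + 2 ℤ.* (+ 2 ℤ.* w)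
  ring = solve-∀

↥-*-+-integer : ∀ (k : ℕ) (a n : ℚ) → IsInt (ℕtoℚ k ℚ.* a) → IsInt n →
                ℚ.↥ (ℕtoℚ k ℚ.* (a ℚ.+ n)) ≡ ℚ.↥ (ℕtoℚ k ℚ.* a) ℤ.+ + k ℤ.* ℚ.↥ n
↥-*-+-integer k a n ia in' = trans (cong ℚ.↥_ asℤtoℚ) (↥-ℤtoℚ _)
  where
  ring : ∀ (k x y : ℚ) → k ℚ.* (x ℚ.+ y) ≡ k ℚ.* x ℚ.+ k ℚ.* y
  ring = RingSolver.solve-∀ ℚ-ring
  asℤtoℚ : ℕtoℚ k ℚ.* (a ℚ.+ n) ≡ ℤtoℚ (ℚ.↥ (ℕtoℚ k ℚ.* a) ℤ.+ + k ℤ.* ℚ.↥ n)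
  asℤtoℚ = begin
    ℕtoℚ k ℚ.* (a ℚ.+ n)                              ≡⟨ ring (ℕtoℚ k) a n ⟩
    ℕtoℚ k ℚ.* a ℚ.+ ℕtoℚ k ℚ.* n                     ≡⟨ cong₂ ℚ._+_ (IsInt⇒≡ℤtoℚ↥ (ℕtoℚ k ℚ.* a) ia)
                                                          (cong (ℕtoℚ k ℚ.*_) (IsInt⇒≡ℤtoℚ↥ n in')) ⟩
    ℤtoℚ (ℚ.↥ (ℕtoℚ k ℚ.* a)) ℚ.+ ℕtoℚ k ℚ.* ℤtoℚ (ℚ.↥ n) ≡⟨ cong (ℚ._+_ (ℤtoℚ A)) (sym (ℤtoℚ-homo-* (+ k) (ℚ.↥ n))) ⟩
    ℤtoℚ (ℚ.↥ (ℕtoℚ k ℚ.* a)) ℚ.+ ℤtoℚ (+ k ℤ.* ℚ.↥ n)   ≡⟨ sym (ℤtoℚ-homo-+ A (+ k ℤ.* ℚ.↥ n)) ⟩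
    ℤtoℚ (ℚ.↥ (ℕtoℚ k ℚ.* a) ℤ.+ + k ℤ.* ℚ.↥ n)         ∎
    where
    open ≡-Reasoning
    A = ℚ.↥ (ℕtoℚ k ℚ.* a)

allV-+2* : ∀ {m} (p : ℤ → Bool) → (∀ z w → p (z ℤ.+ + 2 ℤ.* w) ≡ p z) → (β κ : Vec ℤ m) →
           allV p (Vec.zipWith (λ x y → x ℤ.+ + 2 ℤ.* y) β κ) ≡ allV p β
allV-+2* p invariant [] [] = refl
allV-+2* p invariant (x ∷ β) (y ∷ κ) = cong₂ _∧_ (invariant x y) (allV-+2* p invariant β κ)

module _ {m} (u k : V m) (u∈K' : InK' u) (k∈K : InK k) where

  private
    κα κγ : ℤ
    κα = ℚ.↥ (xa k)
    κγ = ℚ.↥ (xc k)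
    κβ : Vec ℤ m
    κβ = Vec.map ℚ.↥_ (xb k)

  αI-⊕ : αI (u ⊕ k) ≡ αI u ℤ.+ + 4 ℤ.* κα
  αI-⊕ = ↥-*-+-integer 4 (xa u) (xa k) (proj₁ u∈K') (proj₁ k∈K)

  γI-⊕ : γI (u ⊕ k) ≡ γI u ℤ.+ + 4 ℤ.* κγ
  γI-⊕ = ↥-*-+-integer 4 (xc u) (xc k) (proj₂ (proj₂ u∈K')) (proj₂ (proj₂ k∈K))

  βI-⊕ : βI (u ⊕ k) ≡ Vec.zipWith (λ x y → x ℤ.+ + 2 ℤ.* y) (βI u) κβ
  βI-⊕ = coords (xb u) (xb k) (proj₁ (proj₂ u∈K')) (proj₁ (proj₂ k∈K))
    where
    coords : ∀ {m} (v w : Vec ℚ m) → VAll.All IsInt (Vec.map (ℕtoℚ 2 ℚ.*_) v) → VAll.All IsInt w →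
             Vec.map (λ t → ℚ.↥ (ℕtoℚ 2 ℚ.* t)) (Vec.zipWith ℚ._+_ v w)
             ≡ Vec.zipWith (λ x y → x ℤ.+ + 2 ℤ.* y) (Vec.map (λ t → ℚ.↥ (ℕtoℚ 2 ℚ.* t)) v) (Vec.map ℚ.↥_ w)
    coords [] [] [] [] = refl
    coords (x ∷ v) (y ∷ w) (ix ∷ iv) (iy ∷ iw) = cong₂ _∷_ (↥-*-+-integer 2 x y ix iy) (coords v w iv iw)

  allV-βI-⊕ : (p : ℕ → Bool) → allV (λ z → p (resℤ z 2)) (βI (u ⊕ k)) ≡ allV (λ z → p (resℤ z 2)) (βI u)
  allV-βI-⊕ p = trans (cong (allV (λ z → p (resℤ z 2))) βI-⊕)
                      (allV-+2* _ (λ z w → cong p (resℤ-+-multiple 2 z w)) (βI u) κβ)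

  resℤ4-αI-⊕ : resℤ (αI (u ⊕ k)) 4 ≡ resℤ (αI u) 4
  resℤ4-αI-⊕ = trans (cong (λ t → resℤ t 4) αI-⊕) (resℤ-+-multiple 4 (αI u) κα)

  resℤ4-γI-⊕ : resℤ (γI (u ⊕ k)) 4 ≡ resℤ (γI u) 4
  resℤ4-γI-⊕ = trans (cong (λ t → resℤ t 4) γI-⊕) (resℤ-+-multiple 4 (γI u) κγ)

  resℤ2-αI-⊕ : resℤ (αI (u ⊕ k)) 2 ≡ resℤ (αI u) 2
  resℤ2-αI-⊕ = trans (cong (λ t → resℤ t 2) αI-⊕) (resℤ2-+4* (αI u) κα)

  resℤ2-γI-⊕ : resℤ (γI (u ⊕ k)) 2 ≡ resℤ (γI u) 2
  resℤ2-γI-⊕ = trans (cong (λ t → resℤ t 2) γI-⊕) (resℤ2-+4* (γI u) κγ)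

  isμ-⊕ : isμ (u ⊕ k) ≡ isμ u
  isμ-⊕ = cong₃ (λ p q r → is p 2 ∧ is q 2 ∧ r) resℤ4-αI-⊕ resℤ4-γI-⊕ (allV-βI-⊕ (λ r → is r 1))

  in2-⊕ : in2 (u ⊕ k) ≡ in2 u
  in2-⊕ = cong₃ (λ p q r → is p 0 ∧ is q 0 ∧ r) resℤ2-αI-⊕ resℤ2-γI-⊕ (allV-βI-⊕ (λ r → is r 0))

  isZero-⊕ : isZero (u ⊕ k) ≡ isZero u
  isZero-⊕ = cong₃ (λ p q r → is p 0 ∧ is q 0 ∧ r) resℤ4-αI-⊕ resℤ4-γI-⊕ (allV-βI-⊕ (λ r → is r 0))

  -- (α + 4x + 1)(γ + 4y + 1) differs from (α + 1)(γ + 1) by an even number.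
  sgn-⊕ : sgn (u ⊕ k) ≡ sgn u
  sgn-⊕ = cong (λ p → if is p 0 then + 1 else ℤ.- (+ 1))
    (trans (cong (λ t → resℤ t 2) (trans (cong₂ (λ p q → (p ℤ.+ + 1) ℤ.* (q ℤ.+ + 1)) αI-⊕ γI-⊕)
                                         (ring (αI u) (γI u) κα κγ)))
           (resℤ-+-multiple 2 ((αI u ℤ.+ + 1) ℤ.* (γI u ℤ.+ + 1))
             (+ 2 ℤ.* κα ℤ.* (γI u ℤ.+ + 1) ℤ.+ + 2 ℤ.* κγ ℤ.* (αI u ℤ.+ + 1) ℤ.+ + 8 ℤ.* κα ℤ.* κγ)))
    where
    ring : ∀ α γ x y → (α ℤ.+ + 4 ℤ.* x ℤ.+ + 1) ℤ.* (γ ℤ.+ + 4 ℤ.* y ℤ.+ + 1)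
           ≡ (α ℤ.+ + 1) ℤ.* (γ ℤ.+ + 1)
             ℤ.+ + 2 ℤ.* (+ 2 ℤ.* x ℤ.* (γ ℤ.+ + 1) ℤ.+ + 2 ℤ.* y ℤ.* (α ℤ.+ + 1) ℤ.+ + 8 ℤ.* x ℤ.* y)
    ring = solve-∀

  isInt-sub-Qf-⊕ : ∀ n → isInt (n ℚ.- Qf (u ⊕ k)) ≡ isInt (n ℚ.- Qf u)
  isInt-sub-Qf-⊕ n = begin
    isInt (n ℚ.- Qf (u ⊕ k))              ≡⟨ cong (λ t → isInt (n ℚ.- t)) (Qf-⊕ u k) ⟩
    isInt (n ℚ.- (Qf u ℚ.+ Qf k ℚ.+ bil u k)) ≡⟨ cong isInt (ring n (Qf u) (Qf k) (bil u k)) ⟩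
    isInt ((n ℚ.- Qf u) ℚ.+ ℚ.- i)        ≡⟨ isInt-+-integer (n ℚ.- Qf u) (ℚ.- i) (IsInt-neg i i∈ℤ) ⟩
    isInt (n ℚ.- Qf u)                    ∎
    where
    open ≡-Reasoning
    i = Qf k ℚ.+ bil u k
    i∈ℤ : IsInt i
    i∈ℤ = IsInt-+ (Qf k) (bil u k) (IsInt-Qf k k∈K) (IsInt-bil u k u∈K' k∈K)
    ring : ∀ (n q a b : ℚ) → n ℚ.- (q ℚ.+ a ℚ.+ b) ≡ (n ℚ.- q) ℚ.+ ℚ.- (a ℚ.+ b)
    ring = RingSolver.solve-∀ ℚ-ring

  cF-⊕ : ∀ n → cF m (u ⊕ k) n ≡ cF m u n
  cF-⊕ n = cong₅ coefficient isμ-⊕ in2-⊕ isZero-⊕ sgn-⊕ (isInt-sub-Qf-⊕ n)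
    where
    coefficient : Bool → Bool → Bool → ℤ → Bool → ℤ
    coefficient μ two null s integral =
      ((if μ then h0mCoef m n else + 0)
       ℤ.+ (if two then (if null then ℤ.- (+ 1) else + 1) ℤ.* (+ (2 ℕ.^ (m ℕ.∸ 1))) ℤ.* fmCoef m n else + 0))
      ℤ.- s ℤ.* (+ (2 ℕ.^ m)) ℤ.* (if integral then gmCoef m n else + 0)
    cong₅ : ∀ (f : Bool → Bool → Bool → ℤ → Bool → ℤ) {a a' b b' c c' d d' e e'} →
            a ≡ a' → b ≡ b' → c ≡ c' → d ≡ d' → e ≡ e' → f a b c d e ≡ f a' b' c' d' e'
    cong₅ f refl refl refl refl refl = refl

vsumℤ : ∀ {m} → Vec ℤ m → ℤ
vsumℤ = Vec.foldr _ ℤ._+_ (+ 0)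

normSqℤ : ∀ {m} → Vec ℤ m → ℤ
normSqℤ = Vec.foldr _ (λ z r → z ℤ.* z ℤ.+ r) (+ 0)

dotℤ : ∀ {m} → Vec ℤ m → Vec ℤ m → ℤ
dotℤ β b = vsumℤ (Vec.zipWith ℤ._*_ β b)

fromCoords : ∀ {m} → ℤ → Vec ℤ m → ℤ → V m
fromCoords α β γ = vec (ℤtoℚ α ℚ.* ¼) (Vec.map (λ z → ℤtoℚ z ℚ.* ½) β) (ℤtoℚ γ ℚ.* ¼)

Qℤ : ∀ {m} → ℤ → Vec ℤ m → ℤ → ℤ
Qℤ α β γ = α ℤ.* γ ℤ.- normSqℤ β

bilAℤ : ∀ {m} → ℕ → Vec ℤ m → ℕ → ℤ → Vec ℤ m → ℤ → ℤ
bilAℤ a b c α β γ = α ℤ.* + c ℤ.+ γ ℤ.* + a ℤ.- dotℤ β b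

InK'⇒≡fromCoords : ∀ {m} (y : V m) → InK' y → y ≡ fromCoords (αI y) (βI y) (γI y)
InK'⇒≡fromCoords (vec a b c) (ia , ib , ic) =
  cong₃ vec (quarter a ia) (coords b ib) (quarter c ic)
  where
  ring₄ : ∀ (a : ℚ) → a ≡ (ℕtoℚ 4 ℚ.* a) ℚ.* ¼
  ring₄ = RingSolver.solve-∀ ℚ-ring
  ring₂ : ∀ (a : ℚ) → a ≡ (ℕtoℚ 2 ℚ.* a) ℚ.* ½
  ring₂ = RingSolver.solve-∀ ℚ-ring
  quarter : ∀ a → IsInt (ℕtoℚ 4 ℚ.* a) → a ≡ ℤtoℚ (ℚ.↥ (ℕtoℚ 4 ℚ.* a)) ℚ.* ¼
  quarter a ia = trans (ring₄ a) (cong (ℚ._* ¼) (IsInt⇒≡ℤtoℚ↥ (ℕtoℚ 4 ℚ.* a) ia))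
  coords : ∀ {m} (u : Vec ℚ m) → VAll.All IsInt (Vec.map (ℕtoℚ 2 ℚ.*_) u) →
           u ≡ Vec.map (λ z → ℤtoℚ z ℚ.* ½) (Vec.map (λ t → ℚ.↥ (ℕtoℚ 2 ℚ.* t)) u)
  coords [] [] = refl
  coords (x ∷ u) (ix ∷ iu) =
    cong₂ _∷_ (trans (ring₂ x) (cong (ℚ._* ½) (IsInt⇒≡ℤtoℚ↥ (ℕtoℚ 2 ℚ.* x) ix))) (coords u iu)

normSq-halves : ∀ {m} (β : Vec ℤ m) → normSq (Vec.map (λ z → ℤtoℚ z ℚ.* ½) β) ≡ ℤtoℚ (normSqℤ β) ℚ.* ¼
normSq-halves [] = refl
normSq-halves (z ∷ β) = begin
  ℤtoℚ z ℚ.* ½ ℚ.* (ℤtoℚ z ℚ.* ½) ℚ.+ normSq (Vec.map (λ z → ℤtoℚ z ℚ.* ½) β)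
    ≡⟨ cong (ℤtoℚ z ℚ.* ½ ℚ.* (ℤtoℚ z ℚ.* ½) ℚ.+_) (normSq-halves β) ⟩
  ℤtoℚ z ℚ.* ½ ℚ.* (ℤtoℚ z ℚ.* ½) ℚ.+ ℤtoℚ S ℚ.* ¼
    ≡⟨ ring (ℤtoℚ z) (ℤtoℚ S) ⟩
  (ℤtoℚ z ℚ.* ℤtoℚ z ℚ.+ ℤtoℚ S) ℚ.* ¼
    ≡⟨ cong (ℚ._* ¼) (sym (trans (ℤtoℚ-homo-+ (z ℤ.* z) S) (cong (ℚ._+ ℤtoℚ S) (ℤtoℚ-homo-* z z)))) ⟩
  ℤtoℚ (z ℤ.* z ℤ.+ S) ℚ.* ¼ ∎
  where
  open ≡-Reasoning
  S = normSqℤ β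
  ring : ∀ (x s : ℚ) → x ℚ.* ½ ℚ.* (x ℚ.* ½) ℚ.+ s ℚ.* ¼ ≡ (x ℚ.* x ℚ.+ s) ℚ.* ¼
  ring = RingSolver.solve-∀ ℚ-ring

dot-halves : ∀ {m} (β b : Vec ℤ m) →
             dot (Vec.map (λ z → ℤtoℚ z ℚ.* ½) β) (Vec.map ℤtoℚ b) ≡ ℤtoℚ (dotℤ β b) ℚ.* ½
dot-halves [] [] = refl
dot-halves (z ∷ β) (w ∷ b) = begin
  ℤtoℚ z ℚ.* ½ ℚ.* ℤtoℚ w ℚ.+ dot (Vec.map (λ z → ℤtoℚ z ℚ.* ½) β) (Vec.map ℤtoℚ b)
    ≡⟨ cong (ℤtoℚ z ℚ.* ½ ℚ.* ℤtoℚ w ℚ.+_) (dot-halves β b) ⟩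
  ℤtoℚ z ℚ.* ½ ℚ.* ℤtoℚ w ℚ.+ ℤtoℚ S ℚ.* ½
    ≡⟨ ring (ℤtoℚ z) (ℤtoℚ w) (ℤtoℚ S) ⟩
  (ℤtoℚ z ℚ.* ℤtoℚ w ℚ.+ ℤtoℚ S) ℚ.* ½
    ≡⟨ cong (ℚ._* ½) (sym (trans (ℤtoℚ-homo-+ (z ℤ.* w) S) (cong (ℚ._+ ℤtoℚ S) (ℤtoℚ-homo-* z w)))) ⟩
  ℤtoℚ (z ℤ.* w ℤ.+ S) ℚ.* ½ ∎
  where
  open ≡-Reasoning
  S = dotℤ β b
  ring : ∀ (x y s : ℚ) → x ℚ.* ½ ℚ.* y ℚ.+ s ℚ.* ½ ≡ (x ℚ.* y ℚ.+ s) ℚ.* ½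
  ring = RingSolver.solve-∀ ℚ-ring

Qf-fromCoords : ∀ {m} α (β : Vec ℤ m) γ → Qf (fromCoords α β γ) ≡ ℤtoℚ (Qℤ α β γ) ℚ.* ¼
Qf-fromCoords α β γ =
  trans (cong (ℚ._-_ (ℕtoℚ 4 ℚ.* (ℤtoℚ α ℚ.* ¼) ℚ.* (ℤtoℚ γ ℚ.* ¼))) (normSq-halves β))
    (trans (ring (ℤtoℚ α) (ℤtoℚ γ) (ℤtoℚ S))
           (cong (ℚ._* ¼) (sym (trans (ℤtoℚ-homo-sub (α ℤ.* γ) S) (cong (ℚ._- ℤtoℚ S) (ℤtoℚ-homo-* α γ))))))
  where
  S = normSqℤ β
  ring : ∀ (a g s : ℚ) → ℕtoℚ 4 ℚ.* (a ℚ.* ¼) ℚ.* (g ℚ.* ¼) ℚ.- s ℚ.* ¼ ≡ (a ℚ.* g ℚ.- s) ℚ.* ¼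
  ring = RingSolver.solve-∀ ℚ-ring

bil-fromCoords-A : ∀ {m} (a c : ℕ) (b : Vec ℤ m) α β γ →
                   bil (fromCoords α β γ) (Avec a b c) ≡ ℤtoℚ (bilAℤ a b c α β γ)
bil-fromCoords-A a c b α β γ =
  trans (cong (λ s → ℕtoℚ 4 ℚ.* ((ℤtoℚ α ℚ.* ¼) ℚ.* ℕtoℚ c ℚ.+ (ℤtoℚ γ ℚ.* ¼) ℚ.* ℕtoℚ a) ℚ.- ℕtoℚ 2 ℚ.* s)
              (dot-halves β b))
    (trans (ring (ℤtoℚ α) (ℤtoℚ γ) (ℕtoℚ a) (ℕtoℚ c) (ℤtoℚ S))
           (sym (trans (ℤtoℚ-homo-sub (α ℤ.* + c ℤ.+ γ ℤ.* + a) S)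
                       (cong (ℚ._- ℤtoℚ S) (trans (ℤtoℚ-homo-+ (α ℤ.* + c) (γ ℤ.* + a))
                                                  (cong₂ ℚ._+_ (ℤtoℚ-homo-* α (+ c)) (ℤtoℚ-homo-* γ (+ a))))))))
  where
  S = dotℤ β b
  ring : ∀ (α γ a c s : ℚ) → ℕtoℚ 4 ℚ.* ((α ℚ.* ¼) ℚ.* c ℚ.+ (γ ℚ.* ¼) ℚ.* a) ℚ.- ℕtoℚ 2 ℚ.* (s ℚ.* ½)
         ≡ α ℚ.* c ℚ.+ γ ℚ.* a ℚ.- s
  ring = RingSolver.solve-∀ ℚ-ring

ExponentBound : ℕ → ℚ → Set
ExponentBound m n = Σ ℤ λ u → (ℤ.- (+ m) ℤ.≤ u) × (ℕtoℚ 4 ℚ.* n ≡ ℤtoℚ u)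

if-≢0 : ∀ (b : Bool) (v : ℤ) → (if b then v else + 0) ≢ + 0 → v ≢ + 0
if-≢0 true  v h = h
if-≢0 false v h _ = h refl

*≢0⇒≢0ʳ : ∀ (s c v : ℤ) → s ℤ.* c ℤ.* v ≢ + 0 → v ≢ + 0
*≢0⇒≢0ʳ s c v h refl = h (ℤP.*-zeroʳ (s ℤ.* c))

nonzero-summand : ∀ x y z → x ℤ.+ y ℤ.- z ≢ + 0 → x ≢ + 0 ⊎ y ≢ + 0 ⊎ z ≢ + 0
nonzero-summand x y z h with x ℤ.≟ + 0 | y ℤ.≟ + 0 | z ℤ.≟ + 0
... | no x≢0   | _        | _        = inj₁ x≢0
... | yes _    | no y≢0   | _        = inj₂ (inj₁ y≢0)
... | yes _    | yes _    | no z≢0   = inj₂ (inj₂ z≢0)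
... | yes refl | yes refl | yes refl = ⊥-elim (h refl)

coefAt≢0⇒ℕ : ∀ (s : PS) r → coefAt s r ≢ + 0 → Σ ℕ λ k → r ≡ ℤtoℚ (+ k)
coefAt≢0⇒ℕ s r = byDecision (IsInt? r)
  where
  natural : ∀ z → natCoef s z ≢ + 0 → Σ ℕ λ k → z ≡ + k
  natural (+ k)    _ = k , refl
  natural -[1+ _ ] h = ⊥-elim (h refl)
  byDecision : (d : Dec (IsInt r)) → (if does d then natCoef s (ℚ.↥ r) else + 0) ≢ + 0 →
               Σ ℕ λ k → r ≡ ℤtoℚ (+ k)
  byDecision (no _)  h = ⊥-elim (h refl)
  byDecision (yes i) h = let k , e = natural (ℚ.↥ r) h in k , trans (IsInt⇒≡ℤtoℚ↥ r i) (cong ℤtoℚ e)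

ExponentBound-4* : ∀ m n k → n ≡ ℤtoℚ (+ k) → ExponentBound m n
ExponentBound-4* m n k e =
  + (4 ℕ.* k) , ℤP.neg-≤-pos ,
  trans (cong (ℕtoℚ 4 ℚ.*_) e) (sym (trans (cong ℤtoℚ (ℤP.pos-* 4 k)) (ℤtoℚ-homo-* (+ 4) (+ k))))

ExponentBound-h0 : ∀ m n k → n ℚ.+ ℕtoℚ m ℚ.* recip (ℕtoℚ 4) ≡ ℤtoℚ (+ k) → ExponentBound m n
ExponentBound-h0 m n k e =
  + (4 ℕ.* k) ℤ.- + m , ℤP.i≤j+i (ℤ.- (+ m)) (+ (4 ℕ.* k)) ,
  trans (ring n (ℕtoℚ m))
    (trans (cong (λ t → ℕtoℚ 4 ℚ.* t ℚ.- ℕtoℚ m) e)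
      (sym (trans (ℤtoℚ-homo-sub (+ (4 ℕ.* k)) (+ m))
                  (cong (ℚ._- ℕtoℚ m) (trans (cong ℤtoℚ (ℤP.pos-* 4 k)) (ℤtoℚ-homo-* (+ 4) (+ k)))))))
  where
  ring : ∀ (n m : ℚ) → ℕtoℚ 4 ℚ.* n ≡ ℕtoℚ 4 ℚ.* (n ℚ.+ m ℚ.* ¼) ℚ.- m
  ring = RingSolver.solve-∀ ℚ-ring

cF≢0⇒ExponentBound : ∀ m (y : V m) n → cF m y n ≢ + 0 → ExponentBound m n
cF≢0⇒ExponentBound m y n h with nonzero-summand _ _ _ h
... | inj₁ h0≢0 =
  let k , e = coefAt≢0⇒ℕ (H0S m) _ (if-≢0 (isμ y) _ h0≢0) in ExponentBound-h0 m n k e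
... | inj₂ (inj₁ f≢0) =
  let k , e = coefAt≢0⇒ℕ (powS m fS) n (*≢0⇒≢0ʳ (sgn2 y) _ _ (if-≢0 (in2 y) _ f≢0)) in ExponentBound-4* m n k e
... | inj₂ (inj₂ g≢0) =
  let k , e = coefAt≢0⇒ℕ (powS m fS) (ℕtoℚ 4 ℚ.* n) (if-≢0 (isInt (n ℚ.- Qf y)) _ (*≢0⇒≢0ʳ (sgn y) _ _ g≢0))
  in + k , ℤP.neg-≤-pos , e

-- Finiteness of the support

vsumℕ : ∀ {m} → Vec ℕ m → ℕ
vsumℕ = Vec.foldr _ ℕ._+_ 0

sqAbs : ℤ → ℕ
sqAbs w = ℤ.∣ w ∣ ℕ.* ℤ.∣ w ∣

absSum : ∀ {m} → Vec ℤ m → ℕ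
absSum b = vsumℕ (Vec.map ℤ.∣_∣ b)

i*i≡sqAbs : ∀ i → i ℤ.* i ≡ + sqAbs i
i*i≡sqAbs (+ n)    = sym (ℤP.pos-* n n)
i*i≡sqAbs -[1+ n ] = refl

normSqℤ≡vsumℕ-sqAbs : ∀ {m} (v : Vec ℤ m) → normSqℤ v ≡ + vsumℕ (Vec.map sqAbs v)
normSqℤ≡vsumℕ-sqAbs [] = refl
normSqℤ≡vsumℕ-sqAbs (x ∷ v) =
  trans (cong₂ ℤ._+_ (i*i≡sqAbs x) (normSqℤ≡vsumℕ-sqAbs v)) (sym (ℤP.pos-+ (sqAbs x) (vsumℕ (Vec.map sqAbs v))))

i≤∣i∣ : ∀ i → i ℤ.≤ + ℤ.∣ i ∣
i≤∣i∣ (+ n)    = ℤP.≤-refl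
i≤∣i∣ -[1+ n ] = ℤ.-≤+

+-lowerBound⇒≤ : ∀ T D E R K → T ℤ.+ D ℤ.+ E ≡ R → ℤ.- K ℤ.≤ T → D ℤ.+ E ℤ.≤ R ℤ.+ K
+-lowerBound⇒≤ T D E R K eq -K≤T =
  subst₂ ℤ._≤_ (ring₁ D E K) (trans (ring₂ T D E K) (cong (ℤ._+ K) eq))
               (ℤP.+-monoʳ-≤ (D ℤ.+ E) (ℤP.+-monoˡ-≤ K -K≤T))
  where
  ring₁ : ∀ D E K → (D ℤ.+ E) ℤ.+ (ℤ.- K ℤ.+ K) ≡ D ℤ.+ E
  ring₁ = solve-∀
  ring₂ : ∀ T D E K → (D ℤ.+ E) ℤ.+ (T ℤ.+ K) ≡ T ℤ.+ D ℤ.+ E ℤ.+ K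
  ring₂ = solve-∀

x²≤Bx+K⇒x≤B+K : ∀ x B K → x ℕ.* x ℕ.≤ B ℕ.* x ℕ.+ K → x ℕ.≤ B ℕ.+ K
x²≤Bx+K⇒x≤B+K x B K x²≤ with x ℕ.≤? B ℕ.+ K
... | yes x≤ = x≤
... | no x≰ = ⊥-elim (ℕP.<⇒≱ Bx+K<x² x²≤)
  where
  B+K<x : B ℕ.+ K ℕ.< x
  B+K<x = ℕP.≰⇒> x≰
  0<x : 0 ℕ.< x
  0<x = ℕP.<-≤-trans (ℕ.s≤s ℕ.z≤n) B+K<x
  ring : ∀ B K x → B ℕ.* x ℕ.+ (K ℕ.* x ℕ.+ x) ≡ suc (B ℕ.+ K) ℕ.* x
  ring = ℕSolver.solve-∀
  Bx+K<x² : B ℕ.* x ℕ.+ K ℕ.< x ℕ.* x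
  Bx+K<x² = ℕP.<-≤-trans
    (ℕP.+-mono-≤-< (ℕP.≤-refl {B ℕ.* x})
                   (ℕP.≤-<-trans (ℕP.m≤m*n K x {{ℕ.>-nonZero 0<x}}) (ℕP.m<m+n (K ℕ.* x) 0<x)))
    (ℕP.≤-trans (ℕP.≤-reflexive (ring B K x)) (ℕP.*-monoˡ-≤ x B+K<x))

x²≤K⇒x≤K : ∀ x K → x ℕ.* x ℕ.≤ K → x ℕ.≤ K
x²≤K⇒x≤K zero    K _   = ℕ.z≤n
x²≤K⇒x≤K (suc x) K x²≤ = ℕP.≤-trans (ℕP.m≤m*n (suc x) (suc x)) x²≤

All-sqAbs≤vsumℕ : ∀ {m} (v : Vec ℤ m) → VAll.All (λ w → sqAbs w ℕ.≤ vsumℕ (Vec.map sqAbs v)) v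
All-sqAbs≤vsumℕ [] = []
All-sqAbs≤vsumℕ (x ∷ v) =
  ℕP.m≤m+n (sqAbs x) _ ∷ VAll.map (λ le → ℕP.≤-trans le (ℕP.m≤n+m _ (sqAbs x))) (All-sqAbs≤vsumℕ v)

All-abs≤absSum : ∀ {m} (b : Vec ℤ m) → VAll.All (λ w → ℤ.∣ w ∣ ℕ.≤ absSum b) b
All-abs≤absSum [] = []
All-abs≤absSum (x ∷ b) =
  ℕP.m≤m+n ℤ.∣ x ∣ _ ∷ VAll.map (λ le → ℕP.≤-trans le (ℕP.m≤n+m _ ℤ.∣ x ∣)) (All-abs≤absSum b)

∣dotℤ∣≤ : ∀ {m} (Y : ℕ) (β b : Vec ℤ m) → VAll.All (λ z → ℤ.∣ z ∣ ℕ.≤ Y) β → ℤ.∣ dotℤ β b ∣ ℕ.≤ Y ℕ.* absSum b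
∣dotℤ∣≤ Y [] [] [] = ℕ.z≤n
∣dotℤ∣≤ Y (z ∷ β) (w ∷ b) (z≤ ∷ β≤) = begin
  ℤ.∣ z ℤ.* w ℤ.+ dotℤ β b ∣           ≤⟨ ℤP.∣i+j∣≤∣i∣+∣j∣ (z ℤ.* w) (dotℤ β b) ⟩
  ℤ.∣ z ℤ.* w ∣ ℕ.+ ℤ.∣ dotℤ β b ∣     ≡⟨ cong (ℕ._+ ℤ.∣ dotℤ β b ∣) (ℤP.abs-* z w) ⟩
  ℤ.∣ z ∣ ℕ.* ℤ.∣ w ∣ ℕ.+ ℤ.∣ dotℤ β b ∣ ≤⟨ ℕP.+-mono-≤ (ℕP.*-monoˡ-≤ ℤ.∣ w ∣ z≤) (∣dotℤ∣≤ Y β b β≤) ⟩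
  Y ℕ.* ℤ.∣ w ∣ ℕ.+ Y ℕ.* absSum b     ≡⟨ sym (ℕP.*-distribˡ-+ Y ℤ.∣ w ∣ (absSum b)) ⟩
  Y ℕ.* (ℤ.∣ w ∣ ℕ.+ absSum b)         ∎
  where open ℕP.≤-Reasoning

cross : ℕ → ℤ → ℤ → ℤ → ℤ
cross a α z w = + 2 ℤ.* + a ℤ.* z ℤ.- α ℤ.* w

normSqℤ-cross : ∀ {m} (a : ℕ) (α : ℤ) (β b : Vec ℤ m) →
  normSqℤ (Vec.zipWith (cross a α) β b)
  ≡ + 4 ℤ.* + a ℤ.* + a ℤ.* normSqℤ β ℤ.- + 4 ℤ.* + a ℤ.* α ℤ.* dotℤ β b ℤ.+ α ℤ.* α ℤ.* normSqℤ b
normSqℤ-cross a α [] [] = ring (+ a) α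
  where
  ring : ∀ A α → + 0 ≡ + 4 ℤ.* A ℤ.* A ℤ.* + 0 ℤ.- + 4 ℤ.* A ℤ.* α ℤ.* + 0 ℤ.+ α ℤ.* α ℤ.* + 0
  ring = solve-∀
normSqℤ-cross a α (z ∷ β) (w ∷ b) =
  trans (cong (ℤ._+_ (cross a α z w ℤ.* cross a α z w)) (normSqℤ-cross a α β b))
        (ring (+ a) α z w (normSqℤ β) (dotℤ β b) (normSqℤ b))
  where
  ring : ∀ A α z w P S B →
         (+ 2 ℤ.* A ℤ.* z ℤ.- α ℤ.* w) ℤ.* (+ 2 ℤ.* A ℤ.* z ℤ.- α ℤ.* w)
         ℤ.+ (+ 4 ℤ.* A ℤ.* A ℤ.* P ℤ.- + 4 ℤ.* A ℤ.* α ℤ.* S ℤ.+ α ℤ.* α ℤ.* B)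
         ≡ + 4 ℤ.* A ℤ.* A ℤ.* (z ℤ.* z ℤ.+ P) ℤ.- + 4 ℤ.* A ℤ.* α ℤ.* (z ℤ.* w ℤ.+ S)
           ℤ.+ α ℤ.* α ℤ.* (w ℤ.* w ℤ.+ B)
  ring = solve-∀

-- Completing the square: 4a²·4Q(λ) + |D|α² + Σ_j (2aβ_j − αb_j)² = 4aα·(λ, A) for λ = (α/4, β/2, γ/4).
-- On the hyperplane (λ, A) = h with Q(λ) bounded below, this bounds α, then each β_j, then γ.
definite-identity : ∀ {m} (a c : ℕ) (b : Vec ℤ m) α β γ →
  + 4 ℤ.* + a ℤ.* + a ℤ.* Qℤ α β γ ℤ.+ (ℤ.- Disc a b c) ℤ.* α ℤ.* α
  ℤ.+ normSqℤ (Vec.zipWith (cross a α) β b)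
  ≡ + 4 ℤ.* + a ℤ.* α ℤ.* bilAℤ a b c α β γ
definite-identity a c b α β γ =
  trans (cong (ℤ._+_ (+ 4 ℤ.* + a ℤ.* + a ℤ.* Qℤ α β γ ℤ.+ (ℤ.- Disc a b c) ℤ.* α ℤ.* α))
              (normSqℤ-cross a α β b))
        (ring (+ a) (+ c) α γ (normSqℤ β) (dotℤ β b) (normSqℤ b))
  where
  ring : ∀ A C α γ P S B →
         + 4 ℤ.* A ℤ.* A ℤ.* (α ℤ.* γ ℤ.- P) ℤ.+ (ℤ.- (B ℤ.- + 4 ℤ.* A ℤ.* C)) ℤ.* α ℤ.* α
         ℤ.+ (+ 4 ℤ.* A ℤ.* A ℤ.* P ℤ.- + 4 ℤ.* A ℤ.* α ℤ.* S ℤ.+ α ℤ.* α ℤ.* B)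
         ≡ + 4 ℤ.* A ℤ.* α ℤ.* (α ℤ.* C ℤ.+ γ ℤ.* A ℤ.- S)
  ring = solve-∀

Disc<0⇒NonZero : ∀ {m} a c (b : Vec ℤ m) → Disc a b c < + 0 → ℕ.NonZero a
Disc<0⇒NonZero (suc a) c b _ = _
Disc<0⇒NonZero zero c b D<0 = ⊥-elim (ℤP.<⇒≱ D<0 (ℤP.≤-trans (ℤ.+≤+ ℕ.z≤n) (ℤP.≤-reflexive (sym D≡))))
  where
  D≡ : Disc 0 b c ≡ + vsumℕ (Vec.map sqAbs b)
  D≡ = trans (ℤP.+-identityʳ (normSqℤ b)) (normSqℤ≡vsumℕ-sqAbs b)

0<⇒≡suc : ∀ z → + 0 < z → Σ ℕ λ n → z ≡ + suc n
0<⇒≡suc (+ zero)  (ℤ.+<+ ())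
0<⇒≡suc (+ suc n) _ = n , refl

module CoordinateBound {m} (a c : ℕ) (b : Vec ℤ m) (D<0 : Disc a b c < + 0) (h : ℤ) (L : ℕ) where

  instance
    a≢0 : ℕ.NonZero a
    a≢0 = Disc<0⇒NonZero a c b D<0

  B K₀ X K₁ Mβ Mγ coordBound : ℕ
  B  = 4 ℕ.* a ℕ.* ℤ.∣ h ∣
  K₀ = 4 ℕ.* a ℕ.* a ℕ.* L
  X  = B ℕ.+ K₀
  K₁ = B ℕ.* X ℕ.+ K₀
  Mβ = K₁ ℕ.+ X ℕ.* absSum b
  Mγ = ℤ.∣ h ∣ ℕ.+ X ℕ.* c ℕ.+ Mβ ℕ.* absSum b
  coordBound = X ℕ.+ Mβ ℕ.+ Mγ

  module _ (α : ℤ) (β : Vec ℤ m) (γ : ℤ) (onHyperplane : bilAℤ a b c α β γ ≡ h)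
           (Q≥ : ℤ.- (+ L) ℤ.≤ Qℤ α β γ) where

    private
      ∣D∣ : ℕ
      ∣D∣ = suc (proj₁ (0<⇒≡suc (ℤ.- Disc a b c) (ℤP.neg-mono-< D<0)))
      E : ℕ
      E = vsumℕ (Vec.map sqAbs (Vec.zipWith (cross a α) β b))

    -- The identity above with 4a²·4Q(λ) ≥ −4a²L, read in ℕ.
    definite-bound : ∣D∣ ℕ.* sqAbs α ℕ.+ E ℕ.≤ B ℕ.* ℤ.∣ α ∣ ℕ.+ K₀
    definite-bound = ℤP.drop‿+≤+ (begin
      + (∣D∣ ℕ.* sqAbs α ℕ.+ E)                         ≡⟨ lhs ⟩
      D' ℤ.+ normSqℤ (Vec.zipWith (cross a α) β b)       ≤⟨ rearrange ⟩
      + 4 ℤ.* + a ℤ.* α ℤ.* h ℤ.+ + K₀                  ≤⟨ ℤP.+-monoˡ-≤ (+ K₀) 4aαh≤ ⟩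
      + (4 ℕ.* a ℕ.* ℤ.∣ α ∣ ℕ.* ℤ.∣ h ∣) ℤ.+ + K₀      ≡⟨ cong (λ t → + t ℤ.+ + K₀) (ring a ℤ.∣ α ∣ ℤ.∣ h ∣) ⟩
      + (B ℕ.* ℤ.∣ α ∣) ℤ.+ + K₀                         ≡⟨ sym (ℤP.pos-+ (B ℕ.* ℤ.∣ α ∣) K₀) ⟩
      + (B ℕ.* ℤ.∣ α ∣ ℕ.+ K₀)                           ∎)
      where
      open ℤP.≤-Reasoning
      D' = (ℤ.- Disc a b c) ℤ.* α ℤ.* α
      ring : ∀ a x h → 4 ℕ.* a ℕ.* x ℕ.* h ≡ 4 ℕ.* a ℕ.* h ℕ.* x
      ring = ℕSolver.solve-∀
      ∣4aαh∣ : ℤ.∣ + 4 ℤ.* + a ℤ.* α ℤ.* h ∣ ≡ 4 ℕ.* a ℕ.* ℤ.∣ α ∣ ℕ.* ℤ.∣ h ∣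
      ∣4aαh∣ = trans (ℤP.abs-* (+ 4 ℤ.* + a ℤ.* α) h)
                     (cong (ℕ._* ℤ.∣ h ∣) (trans (ℤP.abs-* (+ 4 ℤ.* + a) α)
                                                 (cong (ℕ._* ℤ.∣ α ∣) (ℤP.abs-* (+ 4) (+ a)))))
      4aαh≤ : + 4 ℤ.* + a ℤ.* α ℤ.* h ℤ.≤ + (4 ℕ.* a ℕ.* ℤ.∣ α ∣ ℕ.* ℤ.∣ h ∣)
      4aαh≤ = ℤP.≤-trans (i≤∣i∣ (+ 4 ℤ.* + a ℤ.* α ℤ.* h)) (ℤP.≤-reflexive (cong +_ ∣4aαh∣))
      D'≡ : D' ≡ + (∣D∣ ℕ.* sqAbs α)
      D'≡ = trans (cong (λ t → t ℤ.* α ℤ.* α) (proj₂ (0<⇒≡suc (ℤ.- Disc a b c) (ℤP.neg-mono-< D<0))))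
                  (trans (ℤP.*-assoc (+ ∣D∣) α α)
                         (trans (cong (ℤ._*_ (+ ∣D∣)) (i*i≡sqAbs α)) (sym (ℤP.pos-* ∣D∣ (sqAbs α)))))
      lhs : + (∣D∣ ℕ.* sqAbs α ℕ.+ E) ≡ D' ℤ.+ normSqℤ (Vec.zipWith (cross a α) β b)
      lhs = sym (trans (cong₂ ℤ._+_ D'≡ (normSqℤ≡vsumℕ-sqAbs (Vec.zipWith (cross a α) β b)))
                       (sym (ℤP.pos-+ (∣D∣ ℕ.* sqAbs α) E)))
      4a²Q≥ : ℤ.- (+ K₀) ℤ.≤ + 4 ℤ.* + a ℤ.* + a ℤ.* Qℤ α β γ
      4a²Q≥ = subst₂ ℤ._≤_
        (trans (sym (ℤP.neg-distribʳ-* (+ (4 ℕ.* a ℕ.* a)) (+ L))) (cong ℤ.-_ (sym (ℤP.pos-* (4 ℕ.* a ℕ.* a) L))))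
        (cong (ℤ._* Qℤ α β γ) (trans (ℤP.pos-* (4 ℕ.* a) a) (cong (ℤ._* + a) (ℤP.pos-* 4 a))))
        (ℤP.*-monoˡ-≤-nonNeg (+ (4 ℕ.* a ℕ.* a)) Q≥)
      rearrange : D' ℤ.+ normSqℤ (Vec.zipWith (cross a α) β b) ℤ.≤ + 4 ℤ.* + a ℤ.* α ℤ.* h ℤ.+ + K₀
      rearrange = +-lowerBound⇒≤ _ D' _ _ (+ K₀)
        (trans (definite-identity a c b α β γ) (cong (ℤ._*_ (+ 4 ℤ.* + a ℤ.* α)) onHyperplane)) 4a²Q≥

    α-bound : ℤ.∣ α ∣ ℕ.≤ X
    α-bound = x²≤Bx+K⇒x≤B+K ℤ.∣ α ∣ B K₀
      (ℕP.≤-trans (ℕP.m≤n*m (sqAbs α) ∣D∣) (ℕP.≤-trans (ℕP.m≤m+n (∣D∣ ℕ.* sqAbs α) E) definite-bound))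

    cross-bound : VAll.All (λ w → ℤ.∣ w ∣ ℕ.≤ K₁) (Vec.zipWith (cross a α) β b)
    cross-bound = VAll.map (λ {w} w²≤E → x²≤K⇒x≤K ℤ.∣ w ∣ K₁ (ℕP.≤-trans w²≤E E≤K₁)) (All-sqAbs≤vsumℕ _)
      where
      E≤K₁ : E ℕ.≤ K₁
      E≤K₁ = ℕP.≤-trans (ℕP.≤-trans (ℕP.m≤n+m E (∣D∣ ℕ.* sqAbs α)) definite-bound)
                        (ℕP.+-monoˡ-≤ K₀ (ℕP.*-monoʳ-≤ B α-bound))

    β-bound : VAll.All (λ z → ℤ.∣ z ∣ ℕ.≤ Mβ) β
    β-bound = coords β b cross-bound (All-abs≤absSum b)
      where
      ring : ∀ A z α w → + 2 ℤ.* A ℤ.* z ≡ (+ 2 ℤ.* A ℤ.* z ℤ.- α ℤ.* w) ℤ.+ α ℤ.* w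
      ring = solve-∀
      -- 2aβ_j = cross a α β_j b_j + αb_j
      coord : ∀ z w → ℤ.∣ cross a α z w ∣ ℕ.≤ K₁ → ℤ.∣ w ∣ ℕ.≤ absSum b → ℤ.∣ z ∣ ℕ.≤ Mβ
      coord z w cross≤ w≤ = begin
        ℤ.∣ z ∣                                      ≤⟨ ℕP.m≤n*m ℤ.∣ z ∣ (2 ℕ.* a) {{ℕP.m*n≢0 2 a}} ⟩
        2 ℕ.* a ℕ.* ℤ.∣ z ∣                          ≡⟨ sym (trans (ℤP.abs-* (+ 2 ℤ.* + a) z)
                                                                    (cong (ℕ._* ℤ.∣ z ∣) (ℤP.abs-* (+ 2) (+ a)))) ⟩
        ℤ.∣ + 2 ℤ.* + a ℤ.* z ∣                      ≡⟨ cong ℤ.∣_∣ (ring (+ a) z α w) ⟩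
        ℤ.∣ cross a α z w ℤ.+ α ℤ.* w ∣              ≤⟨ ℤP.∣i+j∣≤∣i∣+∣j∣ (cross a α z w) (α ℤ.* w) ⟩
        ℤ.∣ cross a α z w ∣ ℕ.+ ℤ.∣ α ℤ.* w ∣        ≤⟨ ℕP.+-mono-≤ cross≤ (ℕP.≤-trans (ℕP.≤-reflexive (ℤP.abs-* α w))
                                                                                     (ℕP.*-mono-≤ α-bound w≤)) ⟩
        Mβ                                           ∎
        where open ℕP.≤-Reasoning
      coords : ∀ {k} (β' b' : Vec ℤ k) → VAll.All (λ w → ℤ.∣ w ∣ ℕ.≤ K₁) (Vec.zipWith (cross a α) β' b') →
               VAll.All (λ w → ℤ.∣ w ∣ ℕ.≤ absSum b) b' → VAll.All (λ z → ℤ.∣ z ∣ ℕ.≤ Mβ) β'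
      coords [] [] [] [] = []
      coords (z ∷ β') (w ∷ b') (c≤ ∷ cs) (w≤ ∷ ws) = coord z w c≤ w≤ ∷ coords β' b' cs ws

    -- aγ = h − αc + Σ_j β_j b_j
    γ-bound : ℤ.∣ γ ∣ ℕ.≤ Mγ
    γ-bound = begin
      ℤ.∣ γ ∣                                         ≤⟨ ℕP.m≤m*n ℤ.∣ γ ∣ a ⟩
      ℤ.∣ γ ∣ ℕ.* a                                   ≡⟨ sym (ℤP.abs-* γ (+ a)) ⟩
      ℤ.∣ γ ℤ.* + a ∣                                 ≡⟨ cong ℤ.∣_∣ γa≡ ⟩
      ℤ.∣ h ℤ.- α ℤ.* + c ℤ.+ dotℤ β b ∣              ≤⟨ ℤP.∣i+j∣≤∣i∣+∣j∣ (h ℤ.- α ℤ.* + c) (dotℤ β b) ⟩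
      ℤ.∣ h ℤ.- α ℤ.* + c ∣ ℕ.+ ℤ.∣ dotℤ β b ∣        ≤⟨ ℕP.+-mono-≤ h-αc≤ (∣dotℤ∣≤ Mβ β b β-bound) ⟩
      Mγ                                              ∎
      where
      open ℕP.≤-Reasoning
      ring : ∀ α C γ A S → γ ℤ.* A ≡ (α ℤ.* C ℤ.+ γ ℤ.* A ℤ.- S) ℤ.- α ℤ.* C ℤ.+ S
      ring = solve-∀
      γa≡ : γ ℤ.* + a ≡ h ℤ.- α ℤ.* + c ℤ.+ dotℤ β b
      γa≡ = trans (ring α (+ c) γ (+ a) (dotℤ β b)) (cong (λ t → t ℤ.- α ℤ.* + c ℤ.+ dotℤ β b) onHyperplane)
      h-αc≤ : ℤ.∣ h ℤ.- α ℤ.* + c ∣ ℕ.≤ ℤ.∣ h ∣ ℕ.+ X ℕ.* c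
      h-αc≤ = ℕP.≤-trans (ℤP.∣i-j∣≤∣i∣+∣j∣ h (α ℤ.* + c))
                (ℕP.+-monoʳ-≤ ℤ.∣ h ∣ (ℕP.≤-trans (ℕP.≤-reflexive (ℤP.abs-* α (+ c))) (ℕP.*-monoˡ-≤ c α-bound)))

    coords-bounded : (ℤ.∣ α ∣ ℕ.≤ coordBound) × VAll.All (λ z → ℤ.∣ z ∣ ℕ.≤ coordBound) β
                     × (ℤ.∣ γ ∣ ℕ.≤ coordBound)
    coords-bounded =
      ℕP.≤-trans α-bound (ℕP.≤-trans (ℕP.m≤m+n X Mβ) (ℕP.m≤m+n (X ℕ.+ Mβ) Mγ)) ,
      VAll.map (λ z≤ → ℕP.≤-trans z≤ (ℕP.≤-trans (ℕP.m≤n+m Mβ X) (ℕP.m≤m+n (X ℕ.+ Mβ) Mγ))) β-bound ,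
      ℕP.≤-trans γ-bound (ℕP.m≤n+m Mγ (X ℕ.+ Mβ))

ℤrange : ℕ → List ℤ
ℤrange M = List.map +_ (List.upTo (suc M)) ++ List.map -[1+_] (List.upTo M)

∈-ℤrange : ∀ M z → ℤ.∣ z ∣ ℕ.≤ M → z ∈ ℤrange M
∈-ℤrange M (+ n)    n≤M = ∈-++⁺ˡ (∈-map⁺ +_ (∈-upTo⁺ (ℕ.s≤s n≤M)))
∈-ℤrange M -[1+ n ] n<M = ∈-++⁺ʳ (List.map +_ (List.upTo (suc M))) (∈-map⁺ -[1+_] (∈-upTo⁺ n<M))

vecBox : ∀ m → ℕ → List (Vec ℤ m)
vecBox zero    M = [] ∷ []
vecBox (suc m) M = List.cartesianProductWith _∷_ (ℤrange M) (vecBox m M)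

∈-vecBox : ∀ {m} M (v : Vec ℤ m) → VAll.All (λ z → ℤ.∣ z ∣ ℕ.≤ M) v → v ∈ vecBox m M
∈-vecBox M [] [] = here refl
∈-vecBox M (z ∷ v) (z≤ ∷ v≤) = ∈-cartesianProductWith⁺ _∷_ (∈-ℤrange M z z≤) (∈-vecBox M v v≤)

box : ∀ m → ℕ → List (V m)
box m M = List.cartesianProductWith (λ α βγ → fromCoords α (proj₁ βγ) (proj₂ βγ))
                                    (ℤrange M) (List.cartesianProduct (vecBox m M) (ℤrange M))

∈-box : ∀ {m} M α (β : Vec ℤ m) γ → ℤ.∣ α ∣ ℕ.≤ M → VAll.All (λ z → ℤ.∣ z ∣ ℕ.≤ M) β → ℤ.∣ γ ∣ ℕ.≤ M →
        fromCoords α β γ ∈ box m M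
∈-box M α β γ α≤ β≤ γ≤ =
  ∈-cartesianProductWith⁺ _ (∈-ℤrange M α α≤) (∈-cartesianProductWith⁺ _,_ (∈-vecBox M β β≤) (∈-ℤrange M γ γ≤))

_≟V_ : ∀ {m} (x y : V m) → Dec (x ≡ y)
vec a b c ≟V vec a' b' c' =
  map′ (λ { (refl , refl , refl) → refl }) (λ { refl → refl , refl , refl })
       (a ℚP.≟ a' ×-dec (VecP.≡-dec ℚP._≟_ b b' ×-dec c ℚP.≟ c'))

module _ {A : Set} where

  sumℤ-map-cong : ∀ (f g : A → ℤ) (xs : List A) → (∀ x → x ∈ xs → f x ≡ g x) →
                  sumℤ (List.map f xs) ≡ sumℤ (List.map g xs)
  sumℤ-map-cong f g [] _ = refl
  sumℤ-map-cong f g (x ∷ xs) f≗g =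
    cong₂ ℤ._+_ (f≗g x (here refl)) (sumℤ-map-cong f g xs (λ y y∈ → f≗g y (there y∈)))

  sumℤ-map-+ : ∀ (f g : A → ℤ) (xs : List A) →
               sumℤ (List.map (λ x → f x ℤ.+ g x) xs) ≡ sumℤ (List.map f xs) ℤ.+ sumℤ (List.map g xs)
  sumℤ-map-+ f g [] = refl
  sumℤ-map-+ f g (x ∷ xs) =
    trans (cong (ℤ._+_ (f x ℤ.+ g x)) (sumℤ-map-+ f g xs))
          (ring (f x) (g x) (sumℤ (List.map f xs)) (sumℤ (List.map g xs)))
    where
    ring : ∀ a b c d → a ℤ.+ b ℤ.+ (c ℤ.+ d) ≡ a ℤ.+ c ℤ.+ (b ℤ.+ d)
    ring = solve-∀

  sumℤ-map-0 : ∀ (xs : List A) → sumℤ (List.map (λ _ → + 0) xs) ≡ + 0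
  sumℤ-map-0 [] = refl
  sumℤ-map-0 (x ∷ xs) = trans (ℤP.+-identityˡ _) (sumℤ-map-0 xs)

  indicator : ∀ {P : A → Set} → Decidable P → A → ℤ
  indicator P? x = if does (P? x) then + 1 else + 0

  sumℤ-filter : ∀ {P : A → Set} (P? : Decidable P) (f : A → ℤ) (xs : List A) →
                sumℤ (List.map f (List.filter P? xs)) ≡ sumℤ (List.map (λ x → indicator P? x ℤ.* f x) xs)
  sumℤ-filter P? f [] = refl
  sumℤ-filter P? f (x ∷ xs) with does (P? x)
  ... | true  = cong₂ ℤ._+_ (sym (ℤP.*-identityˡ (f x))) (sumℤ-filter P? f xs)
  ... | false = trans (sumℤ-filter P? f xs)
                      (sym (trans (cong (ℤ._+ sumℤ (List.map (λ x → indicator P? x ℤ.* f x) xs)) (ℤP.*-zeroˡ (f x)))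
                                  (ℤP.+-identityˡ _)))

  sumℤ-indicator≡0 : ∀ {P : A → Set} (P? : Decidable P) (xs : List A) →
                     All (λ x → ¬ P x) xs → sumℤ (List.map (indicator P?) xs) ≡ + 0
  sumℤ-indicator≡0 P? [] [] = refl
  sumℤ-indicator≡0 P? (x ∷ xs) (¬px ∷ ¬pxs) with P? x
  ... | yes px = ⊥-elim (¬px px)
  ... | no  _  = trans (ℤP.+-identityˡ _) (sumℤ-indicator≡0 P? xs ¬pxs)

  sumℤ-indicator≡1 : ∀ {P : A → Set} (P? : Decidable P) (xs : List A) →
                     AllPairs (λ x y → ¬ (P x × P y)) xs → Any P xs → sumℤ (List.map (indicator P?) xs) ≡ + 1
  sumℤ-indicator≡1 P? (x ∷ xs) (x≁xs ∷ xs≁) p∈ with P? x | p∈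
  ... | yes px  | _         =
    cong (ℤ._+_ (+ 1)) (sumℤ-indicator≡0 P? xs (All.map (λ ¬both py → ¬both (px , py)) x≁xs))
  ... | no ¬px  | here px   = ⊥-elim (¬px px)
  ... | no _    | there p∈' = trans (ℤP.+-identityˡ _) (sumℤ-indicator≡1 P? xs xs≁ p∈')

-- The shift by βₕ = (h / 2|D|) A

normSq-ℤtoℚ : ∀ {m} (b : Vec ℤ m) → normSq (Vec.map ℤtoℚ b) ≡ ℤtoℚ (normSqℤ b)
normSq-ℤtoℚ [] = refl
normSq-ℤtoℚ (z ∷ b) =
  trans (cong (ℚ._+_ (ℤtoℚ z ℚ.* ℤtoℚ z)) (normSq-ℤtoℚ b))
        (sym (trans (ℤtoℚ-homo-+ (z ℤ.* z) (normSqℤ b)) (cong (ℚ._+ ℤtoℚ (normSqℤ b)) (ℤtoℚ-homo-* z z))))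

Qf-A : ∀ {m} (a c : ℕ) (b : Vec ℤ m) → Qf (Avec a b c) ≡ absD a b c
Qf-A a c b = begin
  ℕtoℚ 4 ℚ.* ℕtoℚ a ℚ.* ℕtoℚ c ℚ.- normSq (Vec.map ℤtoℚ b)    ≡⟨ cong (ℚ._-_ 4ac′) (normSq-ℤtoℚ b) ⟩
  ℕtoℚ 4 ℚ.* ℕtoℚ a ℚ.* ℕtoℚ c ℚ.- ℤtoℚ B                   ≡⟨ ring (ℕtoℚ a) (ℕtoℚ c) (ℤtoℚ B) ⟩
  ℚ.- (ℤtoℚ B ℚ.- ℕtoℚ 4 ℚ.* ℕtoℚ a ℚ.* ℕtoℚ c)             ≡⟨ cong (λ t → ℚ.- (ℤtoℚ B ℚ.- t)) (sym 4ac) ⟩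
  ℚ.- (ℤtoℚ B ℚ.- ℤtoℚ (+ 4 ℤ.* + a ℤ.* + c))               ≡⟨ cong ℚ.-_ (sym (ℤtoℚ-homo-sub B (+ 4 ℤ.* + a ℤ.* + c))) ⟩
  ℚ.- ℤtoℚ (Disc a b c)                                      ≡⟨ sym (ℤtoℚ-homo-neg (Disc a b c)) ⟩
  absD a b c                                                 ∎
  where
  open ≡-Reasoning
  B = normSqℤ b
  4ac′ = ℕtoℚ 4 ℚ.* ℕtoℚ a ℚ.* ℕtoℚ c
  4ac : ℤtoℚ (+ 4 ℤ.* + a ℤ.* + c) ≡ ℕtoℚ 4 ℚ.* ℕtoℚ a ℚ.* ℕtoℚ c
  4ac = trans (ℤtoℚ-homo-* (+ 4 ℤ.* + a) (+ c)) (cong (ℚ._* ℕtoℚ c) (ℤtoℚ-homo-* (+ 4) (+ a)))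
  ring : ∀ (a c s : ℚ) → ℕtoℚ 4 ℚ.* a ℚ.* c ℚ.- s ≡ ℚ.- (s ℚ.- ℕtoℚ 4 ℚ.* a ℚ.* c)
  ring = RingSolver.solve-∀ ℚ-ring

recip-inverseˡ : ∀ q → q ≢ ℚ.0ℚ → recip q ℚ.* q ≡ ℚ.1ℚ
recip-inverseˡ q q≢0 with q ℚP.≟ ℚ.0ℚ
... | yes q≡0 = ⊥-elim (q≢0 q≡0)
... | no q≢0' = ℚP.*-inverseˡ q {{ℚ.≢-nonZero q≢0'}}

[1+k]*absD≢0 : ∀ {m} (a c : ℕ) (b : Vec ℤ m) (k : ℕ) → Disc a b c < + 0 → ℕtoℚ (suc k) ℚ.* absD a b c ≢ ℚ.0ℚ
[1+k]*absD≢0 a c b k D<0 k∣D∣≡0 = ℤP.<-irrefl (sym k∣D∣≡0ℤ) 0<k∣D∣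
  where
  0<k∣D∣ : + 0 < + suc k ℤ.* ℤ.- Disc a b c
  0<k∣D∣ = subst (_< + suc k ℤ.* ℤ.- Disc a b c) (ℤP.*-zeroʳ (+ suc k))
                 (ℤP.*-monoˡ-<-pos (+ suc k) (ℤP.neg-mono-< D<0))
  k∣D∣≡0ℤ : + suc k ℤ.* ℤ.- Disc a b c ≡ + 0
  k∣D∣≡0ℤ = ℤtoℚ-injective (trans (ℤtoℚ-homo-* (+ suc k) (ℤ.- Disc a b c)) k∣D∣≡0)

module _ {m} (a c : ℕ) (b : Vec ℤ m) (h : ℤ) (D<0 : Disc a b c < + 0) where

  private
    A = Avec a b c
    D = absD a b c
    ρ₂ ρ₄ t : ℚ
    ρ₂ = recip (ℕtoℚ 2 ℚ.* D)
    ρ₄ = recip (ℕtoℚ 4 ℚ.* D)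
    t = ℤtoℚ h ℚ.* ρ₂
    ρ₂-inverse : ρ₂ ℚ.* (ℕtoℚ 2 ℚ.* D) ≡ ℚ.1ℚ
    ρ₂-inverse = recip-inverseˡ _ ([1+k]*absD≢0 a c b 1 D<0)
    ρ₄-inverse : ρ₄ ℚ.* (ℕtoℚ 4 ℚ.* D) ≡ ℚ.1ℚ
    ρ₄-inverse = recip-inverseˡ _ ([1+k]*absD≢0 a c b 3 D<0)

  bil-βh-A : bil (βh a b c h) A ≡ ℤtoℚ h
  bil-βh-A = begin
    bil (t · A) A                        ≡⟨ bil-·ˡ t A A ⟩
    t ℚ.* bil A A                        ≡⟨ cong (t ℚ.*_) (trans (bil-self A) (cong₂ ℚ._+_ (Qf-A a c b) (Qf-A a c b))) ⟩
    t ℚ.* (D ℚ.+ D)                      ≡⟨ ring (ℤtoℚ h) ρ₂ D ⟩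
    ℤtoℚ h ℚ.* (ρ₂ ℚ.* (ℕtoℚ 2 ℚ.* D))   ≡⟨ cong (ℤtoℚ h ℚ.*_) ρ₂-inverse ⟩
    ℤtoℚ h ℚ.* ℚ.1ℚ                      ≡⟨ ℚP.*-identityʳ (ℤtoℚ h) ⟩
    ℤtoℚ h                               ∎
    where
    open ≡-Reasoning
    ring : ∀ (h r D : ℚ) → h ℚ.* r ℚ.* (D ℚ.+ D) ≡ h ℚ.* (r ℚ.* (ℕtoℚ 2 ℚ.* D))
    ring = RingSolver.solve-∀ ℚ-ring

  Qf-βh : Qf (βh a b c h) ≡ hSq a b c h
  Qf-βh = begin
    Qf (t · A)                                            ≡⟨ Qf-· t A ⟩
    t ℚ.* t ℚ.* Qf A                                      ≡⟨ cong (t ℚ.* t ℚ.*_) (Qf-A a c b) ⟩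
    t ℚ.* t ℚ.* D                                         ≡⟨ sym (ℚP.*-identityʳ _) ⟩
    t ℚ.* t ℚ.* D ℚ.* ℚ.1ℚ                                ≡⟨ cong (t ℚ.* t ℚ.* D ℚ.*_) (sym ρ₄-inverse) ⟩
    t ℚ.* t ℚ.* D ℚ.* (ρ₄ ℚ.* (ℕtoℚ 4 ℚ.* D))             ≡⟨ ring (ℤtoℚ h) ρ₂ ρ₄ D ⟩
    ℤtoℚ h ℚ.* ℤtoℚ h ℚ.* ρ₄ ℚ.* (ρ₂ ℚ.* (ℕtoℚ 2 ℚ.* D) ℚ.* (ρ₂ ℚ.* (ℕtoℚ 2 ℚ.* D)))
                                                          ≡⟨ cong (λ z → ℤtoℚ h ℚ.* ℤtoℚ h ℚ.* ρ₄ ℚ.* (z ℚ.* z)) ρ₂-inverse ⟩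
    ℤtoℚ h ℚ.* ℤtoℚ h ℚ.* ρ₄ ℚ.* (ℚ.1ℚ ℚ.* ℚ.1ℚ)         ≡⟨ ℚP.*-identityʳ _ ⟩
    ℤtoℚ h ℚ.* ℤtoℚ h ℚ.* ρ₄                              ≡⟨ cong (ℚ._* ρ₄) (sym (ℤtoℚ-homo-* h h)) ⟩
    hSq a b c h                                           ∎
    where
    open ≡-Reasoning
    ring : ∀ (h ρ₂ ρ₄ D : ℚ) → h ℚ.* ρ₂ ℚ.* (h ℚ.* ρ₂) ℚ.* D ℚ.* (ρ₄ ℚ.* (ℕtoℚ 4 ℚ.* D))
           ≡ h ℚ.* h ℚ.* ρ₄ ℚ.* ((ρ₂ ℚ.* (ℕtoℚ 2 ℚ.* D)) ℚ.* (ρ₂ ℚ.* (ℕtoℚ 2 ℚ.* D)))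
    ring = RingSolver.solve-∀ ℚ-ring

  bil-βhˡ : ∀ (x : V m) → bil (βh a b c h) x ≡ t ℚ.* bil x A
  bil-βhˡ x = trans (bil-·ˡ t A x) (cong (t ℚ.*_) (bil-comm A x))

  bil-βhʳ : ∀ (x : V m) → bil x (βh a b c h) ≡ t ℚ.* bil x A
  bil-βhʳ x = trans (bil-comm x (βh a b c h)) (bil-βhˡ x)

  ⊥A⇒bil-βh≡0 : ∀ (x : V m) → bil x A ≡ ℚ.0ℚ → bil x (βh a b c h) ≡ ℚ.0ℚ
  ⊥A⇒bil-βh≡0 x x⊥A = trans (bil-βhʳ x) (trans (cong (t ℚ.*_) x⊥A) (ℚP.*-zeroʳ t))

  ⊥A⇒bil-⊕βh : ∀ (x : V m) → bil x A ≡ ℚ.0ℚ → bil (x ⊕ βh a b c h) A ≡ ℤtoℚ h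
  ⊥A⇒bil-⊕βh x x⊥A =
    trans (bil-⊕ˡ x (βh a b c h) A) (trans (cong₂ ℚ._+_ x⊥A bil-βh-A) (ℚP.+-identityˡ (ℤtoℚ h)))

  ⊥A⇒Qf-⊕βh : ∀ (x : V m) → bil x A ≡ ℚ.0ℚ → Qf (x ⊕ βh a b c h) ≡ Qf x ℚ.+ hSq a b c h
  ⊥A⇒Qf-⊕βh x x⊥A =
    trans (Qf-⊕ x (βh a b c h))
          (trans (cong₂ (λ p q → Qf x ℚ.+ p ℚ.+ q) Qf-βh (⊥A⇒bil-βh≡0 x x⊥A)) (ℚP.+-identityʳ _))

  bil-⊖βh-A : ∀ (y : V m) → bil y A ≡ ℤtoℚ h → bil (y ⊖ βh a b c h) A ≡ ℚ.0ℚ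
  bil-⊖βh-A y y·A≡h =
    trans (bil-⊖ˡ y (βh a b c h) A) (trans (cong₂ ℚ._-_ y·A≡h bil-βh-A) (ℚP.+-inverseʳ (ℤtoℚ h)))

  bil-⊖βh : ∀ (y n : V m) → bil n A ≡ ℚ.0ℚ → bil (y ⊖ βh a b c h) n ≡ bil y n
  bil-⊖βh y n n⊥A =
    trans (bil-⊖ˡ y (βh a b c h) n)
          (trans (cong (ℚ._-_ (bil y n)) (trans (bil-βhˡ n) (trans (cong (t ℚ.*_) n⊥A) (ℚP.*-zeroʳ t))))
                 (ℚP.+-identityʳ (bil y n)))

∧-split : ∀ {x y} → x ∧ y ≡ true → (x ≡ true) × (y ≡ true)
∧-split {true} {true} refl = refl , refl

InK'⇒inK'≡true : ∀ {m} (u : V m) → InK' u → inK' u ≡ true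
InK'⇒inK'≡true (vec a b c) (ia , ib , ic) =
  cong₃ (λ p q r → p ∧ q ∧ r)
        (IsInt⇒isInt≡true (ℕtoℚ 4 ℚ.* a) ia) (coords b ib) (IsInt⇒isInt≡true (ℕtoℚ 4 ℚ.* c) ic)
  where
  coords : ∀ {m} (u : Vec ℚ m) → VAll.All IsInt (Vec.map (ℕtoℚ 2 ℚ.*_) u) →
           Vec.foldr _ (λ x r → isInt (ℕtoℚ 2 ℚ.* x) ∧ r) true u ≡ true
  coords [] [] = refl
  coords (x ∷ u) (ix ∷ iu) = cong₂ _∧_ (IsInt⇒isInt≡true (ℕtoℚ 2 ℚ.* x) ix) (coords u iu)

inK'≡true⇒InK' : ∀ {m} (u : V m) → inK' u ≡ true → InK' u
inK'≡true⇒InK' (vec a b c) e =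
  let e₁ , e₂₃ = ∧-split {isInt (ℕtoℚ 4 ℚ.* a)} e
      e₂ , e₃ = ∧-split {allInt b} e₂₃
  in isInt≡true⇒IsInt (ℕtoℚ 4 ℚ.* a) e₁ , coords b e₂ , isInt≡true⇒IsInt (ℕtoℚ 4 ℚ.* c) e₃
  where
  allInt : ∀ {m} → Vec ℚ m → Bool
  allInt = Vec.foldr _ (λ x r → isInt (ℕtoℚ 2 ℚ.* x) ∧ r) true
  coords : ∀ {m} (u : Vec ℚ m) → allInt u ≡ true → VAll.All IsInt (Vec.map (ℕtoℚ 2 ℚ.*_) u)
  coords [] _ = []
  coords (x ∷ u) e = let eₓ , eᵤ = ∧-split {isInt (ℕtoℚ 2 ℚ.* x)} e
                     in isInt≡true⇒IsInt (ℕtoℚ 2 ℚ.* x) eₓ ∷ coords u eᵤ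

cFPN≡cF : ∀ m (x : V m) n → InK' x → cFPN m x n ≡ cF m x n
cFPN≡cF m x n x∈K' = cong (λ t → if t then cF m x n else + 0) (InK'⇒inK'≡true x x∈K')

cFPN≢0⇒InK' : ∀ m (x : V m) n → cFPN m x n ≢ + 0 → InK' x
cFPN≢0⇒InK' m x n ≢0 with inK' x in e
... | true  = inK'≡true⇒InK' x e
... | false = ⊥-elim (≢0 refl)

coset-count : ∀ {m} (A : V m) (R : List (V m)) → IsRepSys A R → ∀ x → InN' A x →
              sumℤ (List.map (indicator (λ r → InN? A (x ⊖ r))) R) ≡ + 1
coset-count A R (_ , inequivalent , complete) x x∈N' =
  sumℤ-indicator≡1 (λ r → InN? A (x ⊖ r)) R
    (AllPairs.map (λ {r} {s} r≁s (x∈N+r , x∈N+s) → r≁s (subst (InN A) (sym (r⊖s≡[x⊖s]⊖[x⊖r] x r s))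
                                                       (InN-⊖ A (x ⊖ s) (x ⊖ r) x∈N+s x∈N+r)))
                  inequivalent)
    (∃∈-Any (complete x x∈N'))

module Coefficient {m} (a c : ℕ) (b : Vec ℤ m) (D<0 : Disc a b c < + 0) (h : ℤ) (ℓ : ℚ)
                   (ℓ-h²∈ℤ : IsInt (ℓ ℚ.- hSq a b c h)) where

  private
    A = Avec a b c
    βₕ = βh a b c h
    j = ℚ.↥ (ℓ ℚ.- hSq a b c h)
    L = m ℕ.+ 4 ℕ.* ℤ.∣ j ∣

  OnHyperplane : V m → Set
  OnHyperplane y = InK' y × bil y A ≡ ℤtoℚ h

  OnHyperplane? : Decidable OnHyperplane
  OnHyperplane? y = InK? (dualScale y) ×-dec (bil y A ℚP.≟ ℤtoℚ h)

  coef : V m → ℤ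
  coef y = cF m y (ℓ ℚ.+ Qf y ℚ.- hSq a b c h)

  Contributes : V m → Set
  Contributes y = OnHyperplane y × coef y ≢ + 0

  Contributes? : Decidable Contributes
  Contributes? y = OnHyperplane? y ×-dec ¬? (coef y ℤ.≟ + 0)

  -- 4(ℓ + Q(y) - h²/4|D|) = 4j + 4Q(y) ≥ -m for a contributing y.
  Qℤ-lower-bound : ∀ y → InK' y → coef y ≢ + 0 → ℤ.- (+ L) ℤ.≤ Qℤ (αI y) (βI y) (γI y)
  Qℤ-lower-bound y y∈K' coef≢0 =
    subst₂ ℤ._≤_ (sym -L≡) (sym Qℤ≡) (ℤP.+-mono-≤ u≥-m (ℤP.neg-mono-≤ 4j≤4∣j∣))
    where
    Q₄ = Qℤ (αI y) (βI y) (γI y)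
    bound = cF≢0⇒ExponentBound m y (ℓ ℚ.+ Qf y ℚ.- hSq a b c h) coef≢0
    u = proj₁ bound
    u≥-m = proj₁ (proj₂ bound)
    ring₁ : ∀ (l q s : ℚ) → ℕtoℚ 4 ℚ.* (l ℚ.+ q ℚ.- s) ≡ ℕtoℚ 4 ℚ.* (l ℚ.- s) ℚ.+ ℕtoℚ 4 ℚ.* q
    ring₁ = RingSolver.solve-∀ ℚ-ring
    ring₂ : ∀ (J Q : ℚ) → ℕtoℚ 4 ℚ.* J ℚ.+ ℕtoℚ 4 ℚ.* (Q ℚ.* ¼) ≡ ℕtoℚ 4 ℚ.* J ℚ.+ Q
    ring₂ = RingSolver.solve-∀ ℚ-ring
    ring₃ : ∀ x y → y ≡ (x ℤ.+ y) ℤ.+ ℤ.- x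
    ring₃ = solve-∀
    4n≡ : ℕtoℚ 4 ℚ.* (ℓ ℚ.+ Qf y ℚ.- hSq a b c h) ≡ ℤtoℚ (+ 4 ℤ.* j ℤ.+ Q₄)
    4n≡ = begin
      ℕtoℚ 4 ℚ.* (ℓ ℚ.+ Qf y ℚ.- hSq a b c h)                    ≡⟨ ring₁ ℓ (Qf y) (hSq a b c h) ⟩
      ℕtoℚ 4 ℚ.* (ℓ ℚ.- hSq a b c h) ℚ.+ ℕtoℚ 4 ℚ.* Qf y         ≡⟨ cong₂ (λ p q → ℕtoℚ 4 ℚ.* p ℚ.+ ℕtoℚ 4 ℚ.* q)
                                                                   (IsInt⇒≡ℤtoℚ↥ (ℓ ℚ.- hSq a b c h) ℓ-h²∈ℤ)
                                                                   (trans (cong Qf (InK'⇒≡fromCoords y y∈K'))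
                                                                          (Qf-fromCoords (αI y) (βI y) (γI y))) ⟩
      ℕtoℚ 4 ℚ.* ℤtoℚ j ℚ.+ ℕtoℚ 4 ℚ.* (ℤtoℚ Q₄ ℚ.* ¼)          ≡⟨ ring₂ (ℤtoℚ j) (ℤtoℚ Q₄) ⟩
      ℕtoℚ 4 ℚ.* ℤtoℚ j ℚ.+ ℤtoℚ Q₄                              ≡⟨ cong (ℚ._+ ℤtoℚ Q₄) (sym (ℤtoℚ-homo-* (+ 4) j)) ⟩
      ℤtoℚ (+ 4 ℤ.* j) ℚ.+ ℤtoℚ Q₄                               ≡⟨ sym (ℤtoℚ-homo-+ (+ 4 ℤ.* j) Q₄) ⟩
      ℤtoℚ (+ 4 ℤ.* j ℤ.+ Q₄)                                    ∎
      where open ≡-Reasoning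
    Qℤ≡ : Q₄ ≡ u ℤ.+ ℤ.- (+ 4 ℤ.* j)
    Qℤ≡ = trans (ring₃ (+ 4 ℤ.* j) Q₄)
                (cong (ℤ._+ ℤ.- (+ 4 ℤ.* j))
                      (ℤtoℚ-injective {+ 4 ℤ.* j ℤ.+ Q₄} {u} (trans (sym 4n≡) (proj₂ (proj₂ bound)))))
    4j≤4∣j∣ : + 4 ℤ.* j ℤ.≤ + (4 ℕ.* ℤ.∣ j ∣)
    4j≤4∣j∣ = ℤP.≤-trans (i≤∣i∣ (+ 4 ℤ.* j)) (ℤP.≤-reflexive (cong +_ (ℤP.abs-* (+ 4) j)))
    -L≡ : ℤ.- (+ L) ≡ ℤ.- (+ m) ℤ.+ ℤ.- (+ (4 ℕ.* ℤ.∣ j ∣))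
    -L≡ = trans (cong ℤ.-_ (ℤP.pos-+ m (4 ℕ.* ℤ.∣ j ∣))) (ℤP.neg-distrib-+ (+ m) (+ (4 ℕ.* ℤ.∣ j ∣)))

  open CoordinateBound a c b D<0 h L using (coordBound; coords-bounded)

  Contributes⇒∈box : ∀ y → Contributes y → y ∈ box m coordBound
  Contributes⇒∈box y ((y∈K' , y·A≡h) , coef≢0) =
    subst (_∈ box m coordBound) (sym y≡)
      (∈-box coordBound α β γ (proj₁ bounded) (proj₁ (proj₂ bounded)) (proj₂ (proj₂ bounded)))
    where
    α = αI y
    β = βI y
    γ = γI y
    y≡ : y ≡ fromCoords α β γ
    y≡ = InK'⇒≡fromCoords y y∈K'
    onHyperplane : bilAℤ a b c α β γ ≡ h
    onHyperplane = ℤtoℚ-injective (trans (sym (bil-fromCoords-A a c b α β γ))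
                                         (trans (cong (λ v → bil v A) (sym y≡)) y·A≡h))
    bounded = coords-bounded α β γ onHyperplane (Qℤ-lower-bound y y∈K' coef≢0)

  support : List (V m)
  support = List.filter Contributes? (List.deduplicate _≟V_ (box m coordBound))

  support-unique : Unique support
  support-unique = UniqueP.filter⁺ Contributes? (deduplicate-! _≟V_ (box m coordBound))

  ∈support⇒Contributes : ∀ {y} → y ∈ support → Contributes y
  ∈support⇒Contributes y∈ = proj₂ (∈-filter⁻ Contributes? {xs = List.deduplicate _≟V_ (box m coordBound)} y∈)

  Contributes⇒∈support : ∀ y → Contributes y → y ∈ support
  Contributes⇒∈support y contributes =
    ∈-filter⁺ Contributes? (∈-deduplicate⁺ _≟V_ (Contributes⇒∈box y contributes)) contributes

  rhs : FinSum OnHyperplane coef (sumℤ (List.map coef support))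
  rhs = record
    { support  = support
    ; inS      = All.map proj₁ (AllP.all-filter Contributes? (List.deduplicate _≟V_ (box m coordBound)))
    ; distinct = support-unique
    ; complete = λ y y∈ coef≢0 → Contributes⇒∈support y (y∈ , coef≢0)
    ; total    = refl
    }

  -- The term of c_A(h, ℓ) indexed by a representative r: x ↦ x + βₕ identifies N + r with the
  -- points of the hyperplane whose translate by -βₕ lies in N + r.
  module _ (r : V m) (r⊥A : bil r A ≡ ℚ.0ℚ) where

    InCoset : V m → Set
    InCoset y = InN A ((y ⊖ βₕ) ⊖ r)

    InCoset? : Decidable InCoset
    InCoset? y = InN? A ((y ⊖ βₕ) ⊖ r)

    term : V m → ℤ
    term x = cFPN m (r ⊕ βₕ) (ℓ ℚ.+ Qf x)

    coset⊥A : ∀ x → InN A (x ⊖ r) → bil x A ≡ ℚ.0ℚ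
    coset⊥A x x∈N+r = begin
      bil x A                     ≡⟨ cong (λ v → bil v A) (sym (x⊖t⊕t≡x x r)) ⟩
      bil ((x ⊖ r) ⊕ r) A         ≡⟨ bil-⊕ˡ (x ⊖ r) r A ⟩
      bil (x ⊖ r) A ℚ.+ bil r A   ≡⟨ cong₂ ℚ._+_ (proj₂ x∈N+r) r⊥A ⟩
      ℚ.0ℚ                        ∎
      where open ≡-Reasoning

    coef-⊕βh : ∀ x → InN A (x ⊖ r) → InK' (r ⊕ βₕ) → coef (x ⊕ βₕ) ≡ cF m (r ⊕ βₕ) (ℓ ℚ.+ Qf x)
    coef-⊕βh x x∈N+r r⊕βₕ∈K' = begin
      cF m (x ⊕ βₕ) (ℓ ℚ.+ Qf (x ⊕ βₕ) ℚ.- hSq a b c h)        ≡⟨ cong (λ q → cF m (x ⊕ βₕ) (ℓ ℚ.+ q ℚ.- hSq a b c h))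
                                                                    (⊥A⇒Qf-⊕βh a c b h D<0 x (coset⊥A x x∈N+r)) ⟩
      cF m (x ⊕ βₕ) (ℓ ℚ.+ (Qf x ℚ.+ hSq a b c h) ℚ.- hSq a b c h) ≡⟨ cong (cF m (x ⊕ βₕ)) (ring ℓ (Qf x) (hSq a b c h)) ⟩
      cF m (x ⊕ βₕ) (ℓ ℚ.+ Qf x)                                ≡⟨ cong (λ v → cF m v (ℓ ℚ.+ Qf x)) (x⊕t≡[r⊕t]⊕[x⊖r] x βₕ r) ⟩
      cF m ((r ⊕ βₕ) ⊕ (x ⊖ r)) (ℓ ℚ.+ Qf x)                   ≡⟨ cF-⊕ (r ⊕ βₕ) (x ⊖ r) r⊕βₕ∈K' (proj₁ x∈N+r) (ℓ ℚ.+ Qf x) ⟩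
      cF m (r ⊕ βₕ) (ℓ ℚ.+ Qf x)                                ∎
      where
      open ≡-Reasoning
      ring : ∀ (l q s : ℚ) → l ℚ.+ (q ℚ.+ s) ℚ.- s ≡ l ℚ.+ q
      ring = RingSolver.solve-∀ ℚ-ring

    cosetSupport : List (V m)
    cosetSupport = List.map (_⊖ βₕ) (List.filter InCoset? support)

    term≡coef : ∀ y → y ∈ List.filter InCoset? support → term (y ⊖ βₕ) ≡ coef y
    term≡coef y y∈ = begin
      term (y ⊖ βₕ)                              ≡⟨ cFPN≡cF m (r ⊕ βₕ) (ℓ ℚ.+ Qf (y ⊖ βₕ)) r⊕βₕ∈K' ⟩
      cF m (r ⊕ βₕ) (ℓ ℚ.+ Qf (y ⊖ βₕ))          ≡⟨ sym (coef-⊕βh (y ⊖ βₕ) y∈coset r⊕βₕ∈K') ⟩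
      coef ((y ⊖ βₕ) ⊕ βₕ)                       ≡⟨ cong coef (x⊖t⊕t≡x y βₕ) ⟩
      coef y                                     ∎
      where
      open ≡-Reasoning
      y∈support = proj₁ (∈-filter⁻ InCoset? {xs = support} y∈)
      y∈coset = proj₂ (∈-filter⁻ InCoset? {xs = support} y∈)
      y∈K' : InK' ((y ⊖ βₕ) ⊕ βₕ)
      y∈K' = subst InK' (sym (x⊖t⊕t≡x y βₕ)) (proj₁ (proj₁ (∈support⇒Contributes y∈support)))
      r⊕βₕ∈K' : InK' (r ⊕ βₕ)
      r⊕βₕ∈K' = subst InK' (sym (r⊕t≡[x⊕t]⊖[x⊖r] (y ⊖ βₕ) βₕ r))
                      (InK'-⊖ ((y ⊖ βₕ) ⊕ βₕ) ((y ⊖ βₕ) ⊖ r) y∈K' (proj₁ y∈coset))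

    cosetSupport-complete : ∀ x → InN A (x ⊖ r) → term x ≢ + 0 → x ∈ cosetSupport
    cosetSupport-complete x x∈N+r term≢0 =
      subst (_∈ cosetSupport) (x⊕t⊖t≡x x βₕ) (∈-map⁺ (_⊖ βₕ) y∈)
      where
      r⊕βₕ∈K' = cFPN≢0⇒InK' m (r ⊕ βₕ) (ℓ ℚ.+ Qf x) term≢0
      y = x ⊕ βₕ
      y∈K' : InK' y
      y∈K' = subst InK' (sym (x⊕t≡[r⊕t]⊕[x⊖r] x βₕ r)) (InK'-⊕ (r ⊕ βₕ) (x ⊖ r) r⊕βₕ∈K' (proj₁ x∈N+r))
      coef≢0 : coef y ≢ + 0
      coef≢0 coef≡0 = term≢0 (trans (cFPN≡cF m (r ⊕ βₕ) (ℓ ℚ.+ Qf x) r⊕βₕ∈K')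
                                     (trans (sym (coef-⊕βh x x∈N+r r⊕βₕ∈K')) coef≡0))
      y∈ : y ∈ List.filter InCoset? support
      y∈ = ∈-filter⁺ InCoset?
             (Contributes⇒∈support y ((y∈K' , ⊥A⇒bil-⊕βh a c b h D<0 x (coset⊥A x x∈N+r)) , coef≢0))
             (subst (λ v → InN A (v ⊖ r)) (sym (x⊕t⊖t≡x x βₕ)) x∈N+r)

    coset-FinSum : FinSum (λ x → InN A (x ⊖ r)) term
                          (sumℤ (List.map (λ y → indicator InCoset? y ℤ.* coef y) support))
    coset-FinSum = record
      { support  = cosetSupport
      ; inS      = AllP.map⁺ (AllP.all-filter InCoset? support)
      ; distinct = UniqueP.map⁺ (λ {x} {y} → ⊖-cancelʳ-≡ {x = x} {y} βₕ) (UniqueP.filter⁺ InCoset? support-unique)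
      ; complete = cosetSupport-complete
      ; total    = trans (cong sumℤ (sym (ListP.map-∘ (List.filter InCoset? support))))
                         (trans (sumℤ-map-cong (λ y → term (y ⊖ βₕ)) coef (List.filter InCoset? support) term≡coef)
                                (sumℤ-filter InCoset? coef support))
      }

  multiplicity : List (V m) → V m → ℤ
  multiplicity R y = sumℤ (List.map (indicator (λ r → InN? A ((y ⊖ βₕ) ⊖ r))) R)

  CA-weighted : ∀ R → All (InN' A) R →
                CA m a b c R h ℓ (sumℤ (List.map (λ y → multiplicity R y ℤ.* coef y) support))
  CA-weighted [] [] =
    trans (sumℤ-map-cong _ (λ _ → + 0) support (λ y _ → ℤP.*-zeroˡ (coef y))) (sumℤ-map-0 support)
  CA-weighted (r ∷ R) (r∈N' ∷ R⊆N') =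
    _ , _ , coset-FinSum r (proj₁ r∈N') , CA-weighted R R⊆N' ,
    trans (sumℤ-map-cong _ _ support (λ y _ → ℤP.*-distribʳ-+ (coef y) (isInCoset y) (multiplicity R y)))
          (sumℤ-map-+ (λ y → isInCoset y ℤ.* coef y) (λ y → multiplicity R y ℤ.* coef y) support)
    where
    isInCoset : V m → ℤ
    isInCoset = indicator (InCoset? r (proj₁ r∈N'))

  OnHyperplane⇒⊖βh∈N' : ∀ y → OnHyperplane y → InN' A (y ⊖ βₕ)
  OnHyperplane⇒⊖βh∈N' y (y∈K' , y·A≡h) =
    bil-⊖βh-A a c b h D<0 y y·A≡h ,
    λ n n∈N → subst IsInt (sym (bil-⊖βh a c b h D<0 y n (proj₂ n∈N))) (IsInt-bil y n y∈K' (proj₁ n∈N))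

  CA-value : ∀ R → IsRepSys A R → CA m a b c R h ℓ (sumℤ (List.map coef support))
  CA-value R rep@(R⊆N' , _) = subst (CA m a b c R h ℓ) once (CA-weighted R R⊆N')
    where
    once : sumℤ (List.map (λ y → multiplicity R y ℤ.* coef y) support) ≡ sumℤ (List.map coef support)
    once = sumℤ-map-cong _ coef support λ y y∈ →
      trans (cong (ℤ._* coef y)
                  (coset-count A R rep (y ⊖ βₕ) (OnHyperplane⇒⊖βh∈N' y (proj₁ (∈support⇒Contributes y∈)))))
            (ℤP.*-identityˡ (coef y))

lemma5p4 : (m : ℕ) → 1 ≤ m → m ≤ 3
    → (a c : ℕ) (b : Vec ℤ m) → Disc a b c < + 0
    → (R : List (V m)) → IsRepSys (Avec a b c) R
    → (h : ℤ) (ℓ : ℚ) → IsInt (ℓ - hSq a b c h)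
    → ∃ λ s → CA m a b c R h ℓ s
        × FinSum (λ y → InK' y × bil y (Avec a b c) ≡ ℤtoℚ h)
                 (λ y → cF m y (ℓ + Qf y - hSq a b c h)) s
lemma5p4 m _ _ a c b D<0 R rep h ℓ ℓ-h²∈ℤ = _ , CA-value R rep , rhs
  where open Coefficient a c b D<0 h ℓ ℓ-h²∈ℤ
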